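{- For $k\ge 1$ let $\mathcal{S}^{+}_k$ be the set of primitive self-dual $k\times k$ Fishburn matrices whose corner cell equals $1$, and let \[ \mathbf{S}^{+}_k(v,w,z)=\sum_{M\in\mathcal{S}^{+}_k} v^{\max(M)} w^{\mathrm{se}(M)} z^{\mathrm{dg}(M)}. \] Then for every $k\ge 1$, \[ \mathbf{S}^{+}_{k+2}(v,w,z)=v(1+v)(1+z)\,\mathbf{S}^{+}_k(v+w+vw,\,w,\,z)-v\,\mathbf{S}^{+}_k(v,w,z). \]
   Context: A Fishburn matrix is an upper-triangular square matrix of nonnegative integers in which every row and every column contains a nonzero entry; it is primitive if all entries are $0$ or $1$. Rows and columns of a $k\times k$ matrix are numbered $1,\dots,k$. The corner cell is $(1,k)$. $M$ is self-dual if $M_{ij}=M_{k+1-j,k+1-i}$ for all $i,j$. A cell $(i,j)$ is a diagonal cell if $i+j=k+1$ and an SE-cell if $i+j>k+1$. Statistics: $\max(M)$ = sum of the last column excluding the corner cell; $\mathrm{se}(M)$ = sum of SE-cells not in the last column; $\mathrm{dg}(M)$ = sum of diagonal cells excluding the corner cell. -}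

module Defs where

open import Data.Nat as ℕ using (ℕ; zero; suc; _<_; _≟_; _<?_)
open import Data.Integer as ℤ using (ℤ)
import Data.Fin
open import Data.Fin using (Fin; toℕ; fromℕ; opposite)
open import Data.Fin.Properties using (all?; any?)
open import Data.List using (List; []; _∷_; map; concatMap; filter; foldr; allFin)
open import Data.Vec.Functional using () renaming (_∷_ to _∷ᶠ_)
open import Data.Product using (∃; _×_)
open import Data.Product.Properties using ()
open import Data.Sum using (_⊎_)
open import Relation.Binary.PropositionalEquality using (_≡_; _≢_)
open import Relation.Nullary using (Dec; ¬?; _×-dec_; _⊎-dec_; _→-dec_)
open import Relation.Nullary.Decidable using (⌊_⌋)
open import Data.Bool using (if_then_else_)

-- A k×k matrix of natural numbers; rows/columns indexed 0,…,k-1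
-- (paper's index i corresponds to Fin index i-1).
Matrix : ℕ → Set
Matrix k = Fin k → Fin k → ℕ

allFuns : ∀ {A : Set} n → List A → List (Fin n → A)
allFuns zero    xs = (λ ()) ∷ []
allFuns (suc n) xs = concatMap (λ a → map (λ f → a ∷ᶠ f) (allFuns n xs)) xs

all01Matrices : ∀ k → List (Matrix k)
all01Matrices k = allFuns k (allFuns k (0 ∷ 1 ∷ []))

UpperTriangular : ∀ {k} → Matrix k → Set
UpperTriangular M = ∀ i j → toℕ j < toℕ i → M i j ≡ 0

RowsNonzero : ∀ {k} → Matrix k → Set
RowsNonzero M = ∀ i → ∃ λ j → M i j ≢ 0

ColsNonzero : ∀ {k} → Matrix k → Set
ColsNonzero M = ∀ j → ∃ λ i → M i j ≢ 0

IsFishburn : ∀ {k} → Matrix k → Set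
IsFishburn M = UpperTriangular M × RowsNonzero M × ColsNonzero M

Primitive : ∀ {k} → Matrix k → Set
Primitive M = ∀ i j → (M i j ≡ 0) ⊎ (M i j ≡ 1)

-- Self-dual: M i j = M (k+1-j) (k+1-i)  (opposite i = k-1-i in 0-based indexing).
SelfDual : ∀ {k} → Matrix k → Set
SelfDual M = ∀ i j → M i j ≡ M (opposite j) (opposite i)

-- Matrices of size k = suc n (k ≥ 1); corner cell (1,k) is (zero, fromℕ n).
CornerOne : ∀ {n} → Matrix (suc n) → Set
CornerOne {n} M = M Data.Fin.zero (fromℕ n) ≡ 1

InSplus : ∀ {n} → Matrix (suc n) → Set
InSplus M = IsFishburn M × Primitive M × SelfDual M × CornerOne M

InSplus? : ∀ {n} (M : Matrix (suc n)) → Dec (InSplus M)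
InSplus? {n} M =
  ((all? λ i → all? λ j → (toℕ j <? toℕ i) →-dec (M i j ≟ 0))
   ×-dec (all? λ i → any? λ j → ¬? (M i j ≟ 0))
   ×-dec (all? λ j → any? λ i → ¬? (M i j ≟ 0)))
  ×-dec (all? λ i → all? λ j → (M i j ≟ 0) ⊎-dec (M i j ≟ 1))
  ×-dec (all? λ i → all? λ j → M i j ≟ M (opposite j) (opposite i))
  ×-dec (M Data.Fin.zero (fromℕ n) ≟ 1)

Splus : ∀ n → List (Matrix (suc n))
Splus n = filter InSplus? (all01Matrices (suc n))

sumℕ : List ℕ → ℕ
sumℕ = foldr ℕ._+_ 0

cellSum : ∀ {k} {P : Fin k → Fin k → Set} →
          Matrix k → (∀ i j → Dec (P i j)) → ℕ
cellSum {k} M P? =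
  sumℕ (map (λ i → sumℕ (map (λ j → if ⌊ P? i j ⌋ then M i j else 0) (allFin k))) (allFin k))

-- Statistics for k = suc n (0-based: paper cell (i,j) ↦ (i-1,j-1);
-- diagonal i+j = k+1 ↦ i'+j' = n; SE-cell i+j > k+1 ↦ n < i'+j';
-- last column j = k ↦ j' = n; corner (1,k) ↦ (0,n)).

maxStat : ∀ {n} → Matrix (suc n) → ℕ
maxStat {n} M = cellSum M (λ i j → (toℕ j ≟ n) ×-dec ¬? (toℕ i ≟ 0))

seStat : ∀ {n} → Matrix (suc n) → ℕ
seStat {n} M = cellSum M (λ i j → (n <? (toℕ i ℕ.+ toℕ j)) ×-dec ¬? (toℕ j ≟ n))

dgStat : ∀ {n} → Matrix (suc n) → ℕ
dgStat {n} M = cellSum M (λ i j → ((toℕ i ℕ.+ toℕ j) ≟ n) ×-dec ¬? (toℕ i ≟ 0))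

Sgf : ℕ → ℤ → ℤ → ℤ → ℤ
Sgf n v w z =
  foldr ℤ._+_ (ℤ.+ 0)
    (map (λ M → (v ℤ.^ maxStat M) ℤ.* (w ℤ.^ seStat M) ℤ.* (z ℤ.^ dgStat M)) (Splus n))

-- By self-duality the first row and the last column of a matrix in 𝒮⁺ mirror each other, so a
-- matrix of size k + 2 amounts to a corner c, a first row s and a self-dual upper-triangular
-- k × k 0/1 matrix I, with no condition on the columns of I. Then max = Σ s, se and dg become
-- the sums of I over its whole south-east region and anti-diagonal, and each column but the last
-- is nonzero iff its entry in s or its part inside I is. Summing out c (which must be 1) and s:
--   𝐒⁺_{k+2}(x, w, z) = Σ_I w^se(I) z^dg(I) Π_{j ≤ k} (x + [the part of column j inside I ≠ 0]).
-- Decomposing I in the same way, its first row lies in its south-east region and its corner on its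
-- anti-diagonal: summing the first row out turns every factor v + [·] into (v + w + v w) + [·],
-- and the corner and the last column of I contribute (1 + v)(1 + z) minus one when both vanish;
-- these exceptional terms add up to v 𝐒⁺_k(v, w, z).
module Submission where

open import Defs
open import Level using (0ℓ)
open import Data.Nat as ℕ using (ℕ; zero; suc; z≤n; s≤s; s≤s⁻¹; _∸_; _<_; _≤_)
import Data.Nat.Properties as ℕₚ
import Data.Nat.Tactic.RingSolver as ℕ-Solver
open import Data.Integer using (ℤ; _+_; _-_; _*_; +_; _^_)
import Data.Integer.Properties as ℤₚ
open import Data.Integer.Tactic.RingSolver using (solve-∀)
open import Data.Bool using (Bool; true; false; _∧_; not; if_then_else_)
import Data.Bool.Properties as Boolₚ
open import Data.List using (List; []; _∷_; map; concatMap; filter; foldr; _++_; tabulate; allFin; cartesianProduct)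
open import Data.List.Relation.Unary.All as All using (All; []; _∷_)
import Data.List.Relation.Unary.All.Properties as Allₚ
import Data.List.Properties as Listₚ
open import Data.Fin using (Fin; toℕ; fromℕ<; fromℕ; opposite) renaming (zero to fz; suc to fs)
import Data.Fin.Properties as Finₚ
open import Data.Vec.Functional using () renaming (_∷_ to _∷ᶠ_)
open import Data.Vec.Functional.Relation.Binary.Pointwise.Properties using () renaming (decSetoid to pointwise-decSetoid)
open import Data.Product using (_×_; _,_; proj₁; proj₂; ∃)
open import Data.Product.Relation.Binary.Pointwise.NonDependent using (×-decSetoid)
open import Data.Sum using (_⊎_; inj₁; inj₂)
open import Data.Empty using (⊥-elim)
open import Relation.Binary.Bundles using (DecSetoid)
open import Relation.Binary.PropositionalEquality
open import Relation.Nullary using (Dec; yes; no; does; ¬_; _because_; ofʸ; ofⁿ; contradiction)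
open import Relation.Nullary.Decidable using (⌊_⌋)

𝟙 : Bool → ℤ
𝟙 true = + 1
𝟙 false = + 0

𝟙? : ∀ {P : Set} → Dec P → ℤ
𝟙? P? = 𝟙 (does P?)

𝟙-∧ : ∀ a b → 𝟙 (a ∧ b) ≡ 𝟙 a * 𝟙 b
𝟙-∧ true b = sym (ℤₚ.*-identityˡ (𝟙 b))
𝟙-∧ false b = refl

𝟙-not : ∀ b → 𝟙 (not b) ≡ + 1 - 𝟙 b
𝟙-not true = refl
𝟙-not false = refl

∑ : ∀ {A : Set} → List A → (A → ℤ) → ℤ
∑ [] f = + 0
∑ (x ∷ xs) f = f x + ∑ xs f

foldr-+-map≡∑ : ∀ {A : Set} (xs : List A) (f : A → ℤ) → foldr _+_ (+ 0) (map f xs) ≡ ∑ xs f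
foldr-+-map≡∑ [] f = refl
foldr-+-map≡∑ (x ∷ xs) f = cong (_+_ (f x)) (foldr-+-map≡∑ xs f)

∑-cong : ∀ {A : Set} (xs : List A) {f g : A → ℤ} → (∀ x → f x ≡ g x) → ∑ xs f ≡ ∑ xs g
∑-cong [] h = refl
∑-cong (x ∷ xs) h = cong₂ _+_ (h x) (∑-cong xs h)

∑-cong-All : ∀ {A : Set} {P : A → Set} {xs : List A} {f g : A → ℤ} →
             All P xs → (∀ x → P x → f x ≡ g x) → ∑ xs f ≡ ∑ xs g
∑-cong-All [] h = refl
∑-cong-All (px ∷ pxs) h = cong₂ _+_ (h _ px) (∑-cong-All pxs h)

∑-++ : ∀ {A : Set} (xs ys : List A) f → ∑ (xs ++ ys) f ≡ ∑ xs f + ∑ ys f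
∑-++ [] ys f = sym (ℤₚ.+-identityˡ _)
∑-++ (x ∷ xs) ys f = trans (cong (_+_ (f x)) (∑-++ xs ys f)) (sym (ℤₚ.+-assoc (f x) _ _))

∑-map : ∀ {A B : Set} (h : A → B) (xs : List A) f → ∑ (map h xs) f ≡ ∑ xs (λ x → f (h x))
∑-map h [] f = refl
∑-map h (x ∷ xs) f = cong (_+_ (f (h x))) (∑-map h xs f)

∑-concatMap : ∀ {A B : Set} (h : A → List B) (xs : List A) f →
              ∑ (concatMap h xs) f ≡ ∑ xs (λ a → ∑ (h a) f)
∑-concatMap h [] f = refl
∑-concatMap h (x ∷ xs) f =
  trans (∑-++ (h x) (concatMap h xs) f) (cong (_+_ (∑ (h x) f)) (∑-concatMap h xs f))

∑-cartesianProduct : ∀ {A B : Set} (xs : List A) (ys : List B) f →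
                     ∑ (cartesianProduct xs ys) f ≡ ∑ xs (λ x → ∑ ys (λ y → f (x , y)))
∑-cartesianProduct [] ys f = refl
∑-cartesianProduct (x ∷ xs) ys f =
  trans (∑-++ (map (x ,_) ys) _ f) (cong₂ _+_ (∑-map (x ,_) ys f) (∑-cartesianProduct xs ys f))

∑-filter : ∀ {A : Set} {P : A → Set} (P? : ∀ x → Dec (P x)) (xs : List A) f →
           ∑ (filter P? xs) f ≡ ∑ xs (λ x → 𝟙? (P? x) * f x)
∑-filter P? [] f = refl
∑-filter P? (x ∷ xs) f with does (P? x)
... | true = cong₂ _+_ (sym (ℤₚ.*-identityˡ (f x))) (∑-filter P? xs f)
... | false = trans (∑-filter P? xs f) (sym (ℤₚ.+-identityˡ _))

∑-+ : ∀ {A : Set} (xs : List A) f g → ∑ xs (λ x → f x + g x) ≡ ∑ xs f + ∑ xs g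
∑-+ [] f g = refl
∑-+ (x ∷ xs) f g = trans (cong (_+_ (f x + g x)) (∑-+ xs f g)) (interchange (f x) (g x) (∑ xs f) (∑ xs g))
  where
  interchange : ∀ a b c d → a + b + (c + d) ≡ a + c + (b + d)
  interchange = solve-∀

∑-- : ∀ {A : Set} (xs : List A) f g → ∑ xs (λ x → f x - g x) ≡ ∑ xs f - ∑ xs g
∑-- [] f g = refl
∑-- (x ∷ xs) f g = trans (cong (_+_ (f x - g x)) (∑-- xs f g)) (interchange (f x) (g x) (∑ xs f) (∑ xs g))
  where
  interchange : ∀ a b c d → a - b + (c - d) ≡ a + c - (b + d)
  interchange = solve-∀

∑-*ˡ : ∀ {A : Set} (xs : List A) c f → ∑ xs (λ x → c * f x) ≡ c * ∑ xs f
∑-*ˡ [] c f = sym (ℤₚ.*-zeroʳ c)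
∑-*ˡ (x ∷ xs) c f = trans (cong (_+_ (c * f x)) (∑-*ˡ xs c f)) (sym (ℤₚ.*-distribˡ-+ c (f x) (∑ xs f)))

∑-*ʳ : ∀ {A : Set} (xs : List A) c f → ∑ xs (λ x → f x * c) ≡ ∑ xs f * c
∑-*ʳ xs c f = trans (∑-cong xs (λ x → ℤₚ.*-comm (f x) c)) (trans (∑-*ˡ xs c f) (ℤₚ.*-comm c _))

∑-zero : ∀ {A : Set} (xs : List A) → ∑ xs (λ _ → + 0) ≡ + 0
∑-zero [] = refl
∑-zero (x ∷ xs) = trans (ℤₚ.+-identityˡ _) (∑-zero xs)

∑-swap : ∀ {A B : Set} (xs : List A) (ys : List B) (f : A → B → ℤ) →
         ∑ xs (λ a → ∑ ys (f a)) ≡ ∑ ys (λ b → ∑ xs (λ a → f a b))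
∑-swap [] ys f = sym (∑-zero ys)
∑-swap (x ∷ xs) ys f =
  trans (cong (_+_ (∑ ys (f x))) (∑-swap xs ys f)) (sym (∑-+ ys (f x) (λ b → ∑ xs (λ a → f a b))))

-- Enumerations up to a decidable equivalence

∑-allFuns-suc : ∀ {A : Set} n (xs : List A) F →
                ∑ (allFuns (suc n) xs) F ≡ ∑ xs (λ a → ∑ (allFuns n xs) (λ f → F (a ∷ᶠ f)))
∑-allFuns-suc n xs F = trans (∑-concatMap _ xs F) (∑-cong xs (λ a → ∑-map (a ∷ᶠ_) (allFuns n xs) F))

allFuns-All : ∀ {A : Set} {P : A → Set} n (xs : List A) → All P xs → All (λ f → ∀ i → P (f i)) (allFuns n xs)
allFuns-All zero xs pxs = (λ ()) ∷ []
allFuns-All {P = P} (suc n) xs pxs = Allₚ.concat⁺ (Allₚ.map⁺ (prepend-All pxs))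
  where
  prepend-All : ∀ {ys} → All P ys → All (λ a → All (λ f → ∀ i → P (f i)) (map (a ∷ᶠ_) (allFuns n xs))) ys
  prepend-All [] = []
  prepend-All (pa ∷ pys) =
    Allₚ.map⁺ (All.map (λ pf → λ { fz → pa ; (fs i) → pf i }) (allFuns-All n xs pxs))
    ∷ prepend-All pys

cartesianProduct-All : ∀ {A B : Set} {P : A → Set} {Q : B → Set} {xs ys} →
                       All P xs → All Q ys → All (λ p → P (proj₁ p) × Q (proj₂ p)) (cartesianProduct xs ys)
cartesianProduct-All [] qys = []
cartesianProduct-All (px ∷ pxs) qys =
  Allₚ.++⁺ (Allₚ.map⁺ (All.map (px ,_) qys)) (cartesianProduct-All pxs qys)

module _ (D : DecSetoid 0ℓ 0ℓ) where
  open DecSetoid D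

  count : List Carrier → Carrier → ℤ
  count xs y = ∑ xs (λ x → 𝟙? (x ≟ y))

count-allFuns : ∀ (D : DecSetoid 0ℓ 0ℓ) {S : DecSetoid.Carrier D → Set} xs →
                (∀ y → S y → count D xs y ≡ + 1) →
                ∀ n g → (∀ i → S (g i)) → count (pointwise-decSetoid D n) (allFuns n xs) g ≡ + 1
count-allFuns D xs once zero g Sg = refl
count-allFuns D xs once (suc n) g Sg = begin
  ∑ (allFuns (suc n) xs) (λ f → 𝟙? (f ≟ₙ₊₁ g))
    ≡⟨ ∑-allFuns-suc n xs _ ⟩
  ∑ xs (λ a → ∑ (allFuns n xs) (λ f → 𝟙? ((a ∷ᶠ f) ≟ₙ₊₁ g)))
    ≡⟨ ∑-cong xs (λ a → ∑-cong (allFuns n xs) (λ f → 𝟙-∧ (does (a ≟ g fz)) _)) ⟩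
  ∑ xs (λ a → ∑ (allFuns n xs) (λ f → 𝟙? (a ≟ g fz) * 𝟙? (f ≟ₙ (λ i → g (fs i)))))
    ≡⟨ ∑-cong xs (λ a → ∑-*ˡ (allFuns n xs) (𝟙? (a ≟ g fz)) _) ⟩
  ∑ xs (λ a → 𝟙? (a ≟ g fz) * count (pointwise-decSetoid D n) (allFuns n xs) (λ i → g (fs i)))
    ≡⟨ ∑-*ʳ xs _ _ ⟩
  count D xs (g fz) * count (pointwise-decSetoid D n) (allFuns n xs) (λ i → g (fs i))
    ≡⟨ cong₂ _*_ (once (g fz) (Sg fz)) (count-allFuns D xs once n _ (λ i → Sg (fs i))) ⟩
  + 1 ∎
  where
  open ≡-Reasoning
  open DecSetoid D using (_≟_)
  open DecSetoid (pointwise-decSetoid D (suc n)) using () renaming (_≟_ to _≟ₙ₊₁_)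
  open DecSetoid (pointwise-decSetoid D n) using () renaming (_≟_ to _≟ₙ_)

count-cartesianProduct : ∀ (A B : DecSetoid 0ℓ 0ℓ) xs ys a b →
  count (×-decSetoid A B) (cartesianProduct xs ys) (a , b) ≡ count A xs a * count B ys b
count-cartesianProduct A B xs ys a b = begin
  ∑ (cartesianProduct xs ys) (λ p → 𝟙? (p ≟ (a , b)))
    ≡⟨ ∑-cartesianProduct xs ys _ ⟩
  ∑ xs (λ x → ∑ ys (λ y → 𝟙 (does (x A.≟ a) ∧ does (y B.≟ b))))
    ≡⟨ ∑-cong xs (λ x → trans (∑-cong ys (λ y → 𝟙-∧ (does (x A.≟ a)) _))
                              (∑-*ˡ ys (𝟙? (x A.≟ a)) (λ y → 𝟙? (y B.≟ b)))) ⟩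
  ∑ xs (λ x → 𝟙? (x A.≟ a) * count B ys b)
    ≡⟨ ∑-*ʳ xs _ _ ⟩
  count A xs a * count B ys b ∎
  where
  open ≡-Reasoning
  module A = DecSetoid A
  module B = DecSetoid B
  open DecSetoid (×-decSetoid A B) using (_≟_)

module _ (A B : DecSetoid 0ℓ 0ℓ) where
  private
    module A = DecSetoid A
    module B = DecSetoid B

  module _ (φ : B.Carrier → A.Carrier) (ψ : A.Carrier → B.Carrier)
           (φ-cong : ∀ {b b′} → b B.≈ b′ → φ b A.≈ φ b′)
           (ψ-cong : ∀ {a a′} → a A.≈ a′ → ψ a B.≈ ψ a′)
           (F : A.Carrier → ℤ) (F-cong : ∀ {a a′} → a A.≈ a′ → F a ≡ F a′) where

    private
      transfer : ∀ a b → F a ≡ + 0 ⊎ a A.≈ φ (ψ a) → ψ (φ b) B.≈ b →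
                 𝟙? (b B.≟ ψ a) * F a ≡ 𝟙? (a A.≟ φ b) * F (φ b)
      transfer a b supp ψφb with b B.≟ ψ a | a A.≟ φ b
      ... | yes _ | yes a≈φb = cong (_*_ (+ 1)) (F-cong a≈φb)
      ... | no _ | no _ = refl
      ... | yes b≈ψa | no a≉φb with supp
      ...   | inj₁ Fa≡0 = trans (ℤₚ.*-identityˡ (F a)) Fa≡0
      ...   | inj₂ a≈φψa = contradiction (A.trans a≈φψa (φ-cong (B.sym b≈ψa))) a≉φb
      transfer a b supp ψφb | no b≉ψa | yes a≈φb with supp
      ...   | inj₁ Fa≡0 = sym (trans (ℤₚ.*-identityˡ (F (φ b))) (trans (sym (F-cong a≈φb)) Fa≡0))
      ...   | inj₂ _ = contradiction (B.trans (B.sym ψφb) (ψ-cong (A.sym a≈φb))) b≉ψa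

    ∑-reindex : ∀ {P : A.Carrier → Set} {Q : B.Carrier → Set} xs ys → All P xs → All Q ys →
      (∀ a → P a → count B ys (ψ a) ≡ + 1) → (∀ b → Q b → count A xs (φ b) ≡ + 1) →
      (∀ a → P a → F a ≡ + 0 ⊎ a A.≈ φ (ψ a)) → (∀ b → Q b → ψ (φ b) B.≈ b) →
      ∑ xs F ≡ ∑ ys (λ b → F (φ b))
    ∑-reindex xs ys Pxs Qys ψ-once φ-once supp ψφ≈id = begin
      ∑ xs F
        ≡⟨ ∑-cong-All Pxs (λ a Pa → sym (trans (cong (_* F a) (ψ-once a Pa)) (ℤₚ.*-identityˡ (F a)))) ⟩
      ∑ xs (λ a → count B ys (ψ a) * F a)
        ≡⟨ ∑-cong xs (λ a → sym (∑-*ʳ ys (F a) _)) ⟩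
      ∑ xs (λ a → ∑ ys (λ b → 𝟙? (b B.≟ ψ a) * F a))
        ≡⟨ ∑-swap xs ys _ ⟩
      ∑ ys (λ b → ∑ xs (λ a → 𝟙? (b B.≟ ψ a) * F a))
        ≡⟨ ∑-cong-All Qys (λ b Qb → ∑-cong-All Pxs (λ a Pa → transfer a b (supp a Pa) (ψφ≈id b Qb))) ⟩
      ∑ ys (λ b → ∑ xs (λ a → 𝟙? (a A.≟ φ b) * F (φ b)))
        ≡⟨ ∑-cong-All Qys (λ b Qb → trans (∑-*ʳ xs (F (φ b)) _)
                                     (trans (cong (_* F (φ b)) (φ-once b Qb)) (ℤₚ.*-identityˡ (F (φ b))))) ⟩
      ∑ ys (λ b → F (φ b)) ∎
      where open ≡-Reasoning

Σ< : ℕ → (ℕ → ℕ) → ℕ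
Σ< zero f = 0
Σ< (suc n) f = f 0 ℕ.+ Σ< n (λ a → f (suc a))

Σ<² : ℕ → (ℕ → ℕ → ℕ) → ℕ
Σ<² k f = Σ< k (λ a → Σ< k (f a))

∏< : ℕ → (ℕ → ℤ) → ℤ
∏< zero f = + 1
∏< (suc n) f = f 0 * ∏< n (λ a → f (suc a))

Σ<-snoc : ∀ n f → Σ< (suc n) f ≡ Σ< n f ℕ.+ f n
Σ<-snoc zero f = ℕₚ.+-comm (f 0) 0
Σ<-snoc (suc n) f = trans (cong (f 0 ℕ.+_) (Σ<-snoc n (λ a → f (suc a)))) (sym (ℕₚ.+-assoc (f 0) _ _))

Σ<-cong-< : ∀ n {f g} → (∀ a → a < n → f a ≡ g a) → Σ< n f ≡ Σ< n g
Σ<-cong-< zero h = refl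
Σ<-cong-< (suc n) h = cong₂ ℕ._+_ (h 0 (s≤s z≤n)) (Σ<-cong-< n (λ a p → h (suc a) (s≤s p)))

Σ<-cong : ∀ n {f g} → (∀ a → f a ≡ g a) → Σ< n f ≡ Σ< n g
Σ<-cong n h = Σ<-cong-< n (λ a _ → h a)

Σ<-zero : ∀ n {f} → (∀ a → a < n → f a ≡ 0) → Σ< n f ≡ 0
Σ<-zero zero h = refl
Σ<-zero (suc n) h = cong₂ ℕ._+_ (h 0 (s≤s z≤n)) (Σ<-zero n (λ a p → h (suc a) (s≤s p)))

Σ<-+ : ∀ n f g → Σ< n (λ a → f a ℕ.+ g a) ≡ Σ< n f ℕ.+ Σ< n g
Σ<-+ zero f g = refl
Σ<-+ (suc n) f g =
  trans (cong ((f 0 ℕ.+ g 0) ℕ.+_) (Σ<-+ n (λ a → f (suc a)) (λ a → g (suc a)))) (interchange (f 0) (g 0) _ _)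
  where
  interchange : ∀ a b c d → a ℕ.+ b ℕ.+ (c ℕ.+ d) ≡ a ℕ.+ c ℕ.+ (b ℕ.+ d)
  interchange = ℕ-Solver.solve-∀

Σ<-reverse : ∀ n f → Σ< n (λ a → f (n ∸ suc a)) ≡ Σ< n f
Σ<-reverse zero f = refl
Σ<-reverse (suc n) f =
  trans (cong (f n ℕ.+_) (Σ<-reverse n f)) (trans (ℕₚ.+-comm (f n) (Σ< n f)) (sym (Σ<-snoc n f)))

Σ<-split-ends : ∀ m f → Σ< (suc (suc m)) f ≡ f 0 ℕ.+ (Σ< m (λ a → f (suc a)) ℕ.+ f (suc m))
Σ<-split-ends m f = cong (f 0 ℕ.+_) (Σ<-snoc m (λ a → f (suc a)))

Σ<≢0⇒∃≢0 : ∀ n f → ¬ (Σ< n f ≡ 0) → ∃ λ a → a < n × ¬ (f a ≡ 0)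
Σ<≢0⇒∃≢0 zero f h = ⊥-elim (h refl)
Σ<≢0⇒∃≢0 (suc n) f h with f 0 ℕ.≟ 0
... | no f0≢0 = 0 , s≤s z≤n , f0≢0
... | yes f0≡0 with Σ<≢0⇒∃≢0 n (λ a → f (suc a)) (λ rest≡0 → h (cong₂ ℕ._+_ f0≡0 rest≡0))
...   | a , a<n , fa≢0 = suc a , s≤s a<n , fa≢0

∃≢0⇒Σ<≢0 : ∀ n f a → a < n → ¬ (f a ≡ 0) → ¬ (Σ< n f ≡ 0)
∃≢0⇒Σ<≢0 (suc n) f zero _ f0≢0 h = f0≢0 (ℕₚ.m+n≡0⇒m≡0 (f 0) h)
∃≢0⇒Σ<≢0 (suc n) f (suc a) (s≤s a<n) fa≢0 h =
  ∃≢0⇒Σ<≢0 n (λ a → f (suc a)) a a<n fa≢0 (ℕₚ.m+n≡0⇒n≡0 (f 0) h)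

∏<-snoc : ∀ n f → ∏< (suc n) f ≡ ∏< n f * f n
∏<-snoc zero f = trans (ℤₚ.*-identityʳ (f 0)) (sym (ℤₚ.*-identityˡ (f 0)))
∏<-snoc (suc n) f = trans (cong (f 0 *_) (∏<-snoc n (λ a → f (suc a)))) (sym (ℤₚ.*-assoc (f 0) _ _))

∏<-cong-< : ∀ n {f g} → (∀ a → a < n → f a ≡ g a) → ∏< n f ≡ ∏< n g
∏<-cong-< zero h = refl
∏<-cong-< (suc n) h = cong₂ _*_ (h 0 (s≤s z≤n)) (∏<-cong-< n (λ a p → h (suc a) (s≤s p)))

∏<-cong : ∀ n {f g} → (∀ a → f a ≡ g a) → ∏< n f ≡ ∏< n g
∏<-cong n h = ∏<-cong-< n (λ a _ → h a)

∏<-* : ∀ n f g → ∏< n f * ∏< n g ≡ ∏< n (λ a → f a * g a)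
∏<-* zero f g = refl
∏<-* (suc n) f g =
  trans (interchange (f 0) (g 0) (∏< n (λ a → f (suc a))) (∏< n (λ a → g (suc a))))
        (cong (f 0 * g 0 *_) (∏<-* n (λ a → f (suc a)) (λ a → g (suc a))))
  where
  interchange : ∀ a b c d → a * c * (b * d) ≡ a * b * (c * d)
  interchange = solve-∀

^-Σ< : ∀ x n f → x ^ Σ< n f ≡ ∏< n (λ a → x ^ f a)
^-Σ< x zero f = refl
^-Σ< x (suc n) f =
  trans (ℤₚ.^-distribˡ-+-* x (f 0) (Σ< n (λ a → f (suc a)))) (cong (x ^ f 0 *_) (^-Σ< x n (λ a → f (suc a))))

bits : List ℕ
bits = 0 ∷ 1 ∷ []

Bit : ℕ → Set
Bit y = y ≡ 0 ⊎ y ≡ 1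

bits-Bit : All Bit bits
bits-Bit = inj₁ refl ∷ inj₂ refl ∷ []

Bit-if : ∀ (t : Bool) {x y} → Bit x → Bit y → Bit (if t then x else y)
Bit-if true bx by = bx
Bit-if false bx by = by

BitMatrix : ∀ {k} → Matrix k → Set
BitMatrix M = ∀ i j → Bit (M i j)

all01Matrices-Bit : ∀ k → All BitMatrix (all01Matrices k)
all01Matrices-Bit k = allFuns-All k _ (allFuns-All k bits bits-Bit)

extend : ∀ {m} → (Fin m → ℕ) → ℕ → ℕ
extend {zero} f _ = 0
extend {suc m} f zero = f fz
extend {suc m} f (suc a) = extend (λ i → f (fs i)) a

extend-toℕ : ∀ {m} (f : Fin m → ℕ) i → extend f (toℕ i) ≡ f i
extend-toℕ {suc m} f fz = refl
extend-toℕ {suc m} f (fs i) = extend-toℕ (λ j → f (fs j)) i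

extend-≥ : ∀ {m} (f : Fin m → ℕ) a → m ≤ a → extend f a ≡ 0
extend-≥ {zero} f a _ = refl
extend-≥ {suc m} f (suc a) (s≤s p) = extend-≥ (λ j → f (fs j)) a p

extend-cong : ∀ {m} {f g : Fin m → ℕ} → (∀ i → f i ≡ g i) → ∀ a → extend f a ≡ extend g a
extend-cong {zero} h a = refl
extend-cong {suc m} h zero = h fz
extend-cong {suc m} h (suc a) = extend-cong (λ i → h (fs i)) a

extend-tabulate : ∀ m (g : ℕ → ℕ) a → a < m → extend {m} (λ j → g (toℕ j)) a ≡ g a
extend-tabulate (suc m) g zero _ = refl
extend-tabulate (suc m) g (suc a) (s≤s p) = extend-tabulate m (λ x → g (suc x)) a p

extend-Bit : ∀ {m} (f : Fin m → ℕ) → (∀ i → Bit (f i)) → ∀ a → Bit (extend f a)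
extend-Bit {zero} f h a = inj₁ refl
extend-Bit {suc m} f h zero = h fz
extend-Bit {suc m} f h (suc a) = extend-Bit (λ i → f (fs i)) (λ i → h (fs i)) a

∑-allFuns-∏< : ∀ n (xs : List ℕ) (g : ℕ → ℕ → ℤ) →
               ∑ (allFuns n xs) (λ f → ∏< n (λ j → g j (extend f j))) ≡ ∏< n (λ j → ∑ xs (g j))
∑-allFuns-∏< zero xs g = refl
∑-allFuns-∏< (suc n) xs g =
  trans (∑-allFuns-suc n xs _)
  (trans (∑-cong xs (λ a → ∑-*ˡ (allFuns n xs) (g 0 a) _))
  (trans (∑-cong xs (λ a → cong (g 0 a *_) (∑-allFuns-∏< n xs (λ j → g (suc j)))))
  (∑-*ʳ xs _ (g 0))))

_≈ᴹ_ : ∀ {k} → Matrix k → Matrix k → Set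
M ≈ᴹ N = ∀ i j → M i j ≡ N i j

entry : ∀ {k} → Matrix k → ℕ → ℕ → ℕ
entry M a b = extend (λ i → extend (M i) b) a

entry-toℕ : ∀ {k} (M : Matrix k) i j → entry M (toℕ i) (toℕ j) ≡ M i j
entry-toℕ M i j = trans (extend-toℕ (λ i → extend (M i) (toℕ j)) i) (extend-toℕ (M i) j)

entry-cong : ∀ {k} {M N : Matrix k} → M ≈ᴹ N → ∀ a b → entry M a b ≡ entry N a b
entry-cong M≈N a b = extend-cong (λ i → extend-cong (M≈N i) b) a

entry-≥-row : ∀ {k} (M : Matrix k) a b → k ≤ a → entry M a b ≡ 0
entry-≥-row M a b p = extend-≥ _ a p

entry-tabulate : ∀ k (g : ℕ → ℕ → ℕ) a b → a < k → b < k →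
                 entry {k} (λ i j → g (toℕ i) (toℕ j)) a b ≡ g a b
entry-tabulate k g a b p q =
  trans (extend-tabulate k (λ x → extend {k} (λ j → g x (toℕ j)) b) a p) (extend-tabulate k (g a) b q)

entry-Bit : ∀ {k} (M : Matrix k) → BitMatrix M → ∀ a b → Bit (entry M a b)
entry-Bit M h a b = extend-Bit _ (λ i → extend-Bit (M i) (h i) b) a

Fin²⇒ℕ² : ∀ {k} {Q : ℕ → ℕ → Set} → (∀ (i j : Fin k) → Q (toℕ i) (toℕ j)) →
          ∀ a b → a < k → b < k → Q a b
Fin²⇒ℕ² {Q = Q} h a b p q = subst₂ Q (Finₚ.toℕ-fromℕ< p) (Finₚ.toℕ-fromℕ< q) (h (fromℕ< p) (fromℕ< q))

sumℕ-map-tabulate : ∀ {X : Set} k (f : Fin k → X) (h : X → ℕ) (g : ℕ → ℕ) →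
                    (∀ i → h (f i) ≡ g (toℕ i)) → sumℕ (map h (tabulate f)) ≡ Σ< k g
sumℕ-map-tabulate zero f h g hf = refl
sumℕ-map-tabulate (suc k) f h g hf =
  cong₂ ℕ._+_ (hf fz) (sumℕ-map-tabulate k (λ i → f (fs i)) h (λ a → g (suc a)) (λ i → hf (fs i)))

isYes≡does : ∀ {P : Set} (P? : Dec P) → ⌊ P? ⌋ ≡ does P?
isYes≡does (true because _) = refl
isYes≡does (false because _) = refl

cellSum-Σ< : ∀ {k} {P : Fin k → Fin k → Set} (M : Matrix k) (P? : ∀ i j → Dec (P i j)) (q : ℕ → ℕ → Bool) →
             (∀ i j → does (P? i j) ≡ q (toℕ i) (toℕ j)) →
             cellSum M P? ≡ Σ<² k (λ a b → if q a b then entry M a b else 0)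
cellSum-Σ< {k} M P? q P?≡q =
  sumℕ-map-tabulate k (λ i → i) _ _ (λ i → sumℕ-map-tabulate k (λ j → j) _ _ (cell i))
  where
  cell : ∀ i j → (if ⌊ P? i j ⌋ then M i j else 0)
               ≡ (if q (toℕ i) (toℕ j) then entry M (toℕ i) (toℕ j) else 0)
  cell i j rewrite isYes≡does (P? i j) | P?≡q i j | entry-toℕ M i j = refl

rowSetoid : ℕ → DecSetoid 0ℓ 0ℓ
rowSetoid = pointwise-decSetoid ℕₚ.≡-decSetoid

matrixSetoid : ℕ → DecSetoid 0ℓ 0ℓ
matrixSetoid k = pointwise-decSetoid (rowSetoid k) k

count-bits : ∀ y → Bit y → count ℕₚ.≡-decSetoid bits y ≡ + 1
count-bits .0 (inj₁ refl) = refl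
count-bits .1 (inj₂ refl) = refl

count-all01Matrices : ∀ k (N : Matrix k) → BitMatrix N → count (matrixSetoid k) (all01Matrices k) N ≡ + 1
count-all01Matrices k = count-allFuns (rowSetoid k) (allFuns k bits)
  (λ row bits-row → count-allFuns ℕₚ.≡-decSetoid bits count-bits k row bits-row) k

∧≡true⁻ : ∀ {a b} → a ∧ b ≡ true → a ≡ true × b ≡ true
∧≡true⁻ {true} {true} _ = refl , refl

∧≡true⁺ : ∀ {a b} → a ≡ true → b ≡ true → a ∧ b ≡ true
∧≡true⁺ refl refl = refl

Bool-≡ : ∀ {a b : Bool} → (a ≡ true → b ≡ true) → (b ≡ true → a ≡ true) → a ≡ b
Bool-≡ {true} {true} f g = refl
Bool-≡ {false} {false} f g = refl
Bool-≡ {true} {false} f g = sym (f refl)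
Bool-≡ {false} {true} f g = g refl

≡ᵇ-sound : ∀ x y → (x ℕ.≡ᵇ y) ≡ true → x ≡ y
≡ᵇ-sound zero zero _ = refl
≡ᵇ-sound (suc x) (suc y) h = cong suc (≡ᵇ-sound x y h)

≡ᵇ-complete : ∀ x y → x ≡ y → (x ℕ.≡ᵇ y) ≡ true
≡ᵇ-complete zero .zero refl = refl
≡ᵇ-complete (suc x) .(suc x) refl = ≡ᵇ-complete x x refl

≡ᵇ-refl : ∀ n → (n ℕ.≡ᵇ n) ≡ true
≡ᵇ-refl n = ≡ᵇ-complete n n refl

≢⇒≡ᵇ-false : ∀ a b → ¬ (a ≡ b) → (a ℕ.≡ᵇ b) ≡ false
≢⇒≡ᵇ-false a b a≢b with a ℕ.≡ᵇ b in e
... | true = ⊥-elim (a≢b (≡ᵇ-sound a b e))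
... | false = refl

≡ᵇ-false⇒≢ : ∀ a b → (a ℕ.≡ᵇ b) ≡ false → ¬ (a ≡ b)
≡ᵇ-false⇒≢ a b h a≡b with trans (sym h) (≡ᵇ-complete a b a≡b)
... | ()

<⇒≡ᵇ-false : ∀ a b → a < b → (a ℕ.≡ᵇ b) ≡ false
<⇒≡ᵇ-false zero (suc b) _ = refl
<⇒≡ᵇ-false (suc a) (suc b) (s≤s p) = <⇒≡ᵇ-false a b p

<ᵇ-sound : ∀ a b → (a ℕ.<ᵇ b) ≡ true → a < b
<ᵇ-sound zero (suc b) _ = s≤s z≤n
<ᵇ-sound (suc a) (suc b) h = s≤s (<ᵇ-sound a b h)

<ᵇ-complete : ∀ a b → a < b → (a ℕ.<ᵇ b) ≡ true
<ᵇ-complete zero (suc b) _ = refl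
<ᵇ-complete (suc a) (suc b) (s≤s p) = <ᵇ-complete a b p

<ᵇ-false⇒≮ : ∀ a b → (a ℕ.<ᵇ b) ≡ false → ¬ (a < b)
<ᵇ-false⇒≮ a b h a<b with trans (sym h) (<ᵇ-complete a b a<b)
... | ()

not≡ᵇ0-sound : ∀ x → not (x ℕ.≡ᵇ 0) ≡ true → ¬ (x ≡ 0)
not≡ᵇ0-sound (suc x) h ()

not≡ᵇ0-complete : ∀ x → ¬ (x ≡ 0) → not (x ℕ.≡ᵇ 0) ≡ true
not≡ᵇ0-complete zero x≢0 = ⊥-elim (x≢0 refl)
not≡ᵇ0-complete (suc x) x≢0 = refl

allᵇ : ℕ → (ℕ → Bool) → Bool
allᵇ zero p = true
allᵇ (suc n) p = p 0 ∧ allᵇ n (λ a → p (suc a))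

allᵇ-sound : ∀ n p → allᵇ n p ≡ true → ∀ a → a < n → p a ≡ true
allᵇ-sound (suc n) p h zero _ = proj₁ (∧≡true⁻ h)
allᵇ-sound (suc n) p h (suc a) (s≤s q) = allᵇ-sound n (λ a → p (suc a)) (proj₂ (∧≡true⁻ {p 0} h)) a q

allᵇ-complete : ∀ n p → (∀ a → a < n → p a ≡ true) → allᵇ n p ≡ true
allᵇ-complete zero p h = refl
allᵇ-complete (suc n) p h =
  ∧≡true⁺ (h 0 (s≤s z≤n)) (allᵇ-complete n (λ a → p (suc a)) (λ a q → h (suc a) (s≤s q)))

allᵇ-cong : ∀ n {p q} → (∀ a → a < n → p a ≡ q a) → allᵇ n p ≡ allᵇ n q
allᵇ-cong zero h = refl
allᵇ-cong (suc n) h = cong₂ _∧_ (h 0 (s≤s z≤n)) (allᵇ-cong n (λ a r → h (suc a) (s≤s r)))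

allᵇ-snoc : ∀ n p → allᵇ (suc n) p ≡ allᵇ n p ∧ p n
allᵇ-snoc zero p = Boolₚ.∧-comm (p 0) true
allᵇ-snoc (suc n) p = trans (cong (p 0 ∧_) (allᵇ-snoc n (λ a → p (suc a)))) (sym (Boolₚ.∧-assoc (p 0) _ _))

𝟙-allᵇ : ∀ n p → 𝟙 (allᵇ n p) ≡ ∏< n (λ a → 𝟙 (p a))
𝟙-allᵇ zero p = refl
𝟙-allᵇ (suc n) p = trans (𝟙-∧ (p 0) _) (cong (𝟙 (p 0) *_) (𝟙-allᵇ n (λ a → p (suc a))))

UpperTriangularℕ : ∀ k → Matrix k → Set
UpperTriangularℕ k M = ∀ a b → a < k → b < k → b < a → entry M a b ≡ 0

-- k ∸ suc a is the 0-based index of the row/column opposite to a.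
SelfDualℕ : ∀ k → Matrix k → Set
SelfDualℕ k M = ∀ a b → a < k → b < k → entry M a b ≡ entry M (k ∸ suc b) (k ∸ suc a)

lowerCellZeroᵇ : ℕ → ℕ → ℕ → Bool
lowerCellZeroᵇ a b x = if b ℕ.<ᵇ a then x ℕ.≡ᵇ 0 else true

utsdᵇ : ∀ k → Matrix k → Bool
utsdᵇ k M = allᵇ k (λ a → allᵇ k (λ b → lowerCellZeroᵇ a b (entry M a b)))
          ∧ allᵇ k (λ a → allᵇ k (λ b → entry M a b ℕ.≡ᵇ entry M (k ∸ suc b) (k ∸ suc a)))

lowerCellZeroᵇ-sound : ∀ a b x → lowerCellZeroᵇ a b x ≡ true → b < a → x ≡ 0
lowerCellZeroᵇ-sound a b x h b<a with b ℕ.<ᵇ a in e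
... | true = ≡ᵇ-sound x 0 h
... | false = ⊥-elim (<ᵇ-false⇒≮ b a e b<a)

lowerCellZeroᵇ-complete : ∀ a b x → (b < a → x ≡ 0) → lowerCellZeroᵇ a b x ≡ true
lowerCellZeroᵇ-complete a b x h with b ℕ.<ᵇ a in e
... | true = ≡ᵇ-complete x 0 (h (<ᵇ-sound b a e))
... | false = refl

utsdᵇ-sound : ∀ k M → utsdᵇ k M ≡ true → UpperTriangularℕ k M × SelfDualℕ k M
utsdᵇ-sound k M h with ∧≡true⁻ {allᵇ k _} h
... | ut , sd = (λ a b p q → lowerCellZeroᵇ-sound a b _ (allᵇ-sound k _ (allᵇ-sound k _ ut a p) b q))
              , (λ a b p q → ≡ᵇ-sound _ _ (allᵇ-sound k _ (allᵇ-sound k _ sd a p) b q))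

utsdᵇ-complete : ∀ k M → UpperTriangularℕ k M × SelfDualℕ k M → utsdᵇ k M ≡ true
utsdᵇ-complete k M (ut , sd) = ∧≡true⁺
  (allᵇ-complete k _ (λ a p → allᵇ-complete k _ (λ b q → lowerCellZeroᵇ-complete a b _ (ut a b p q))))
  (allᵇ-complete k _ (λ a p → allᵇ-complete k _ (λ b q → ≡ᵇ-complete _ _ (sd a b p q))))

utsdᵇ-cong : ∀ k {M N : Matrix k} → M ≈ᴹ N → utsdᵇ k M ≡ utsdᵇ k N
utsdᵇ-cong k M≈N = cong₂ _∧_
  (allᵇ-cong k (λ a _ → allᵇ-cong k (λ b _ → cong (lowerCellZeroᵇ a b) (entry-cong M≈N a b))))
  (allᵇ-cong k (λ a _ → allᵇ-cong k (λ b _ → cong₂ ℕ._≡ᵇ_ (entry-cong M≈N a b) (entry-cong M≈N _ _))))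

colSum : ∀ k → Matrix k → ℕ → ℕ
colSum k M b = Σ< k (λ a → entry M a b)

colSum-cong : ∀ k {M N : Matrix k} → M ≈ᴹ N → ∀ b → colSum k M b ≡ colSum k N b
colSum-cong k M≈N b = Σ<-cong k (λ a → entry-cong M≈N a b)

colsNonzeroᵇ : ∀ k → Matrix k → Bool
colsNonzeroᵇ k M = allᵇ k (λ b → not (colSum k M b ℕ.≡ᵇ 0))

colsNonzeroᵇ-cong : ∀ k {M N : Matrix k} → M ≈ᴹ N → colsNonzeroᵇ k M ≡ colsNonzeroᵇ k N
colsNonzeroᵇ-cong k M≈N = allᵇ-cong k (λ b _ → cong (λ t → not (t ℕ.≡ᵇ 0)) (colSum-cong k M≈N b))

isYes-reflects : ∀ {P : Set} (P? : Dec P) (b : Bool) → (P → b ≡ true) → (b ≡ true → P) → ⌊ P? ⌋ ≡ b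
isYes-reflects (true because ofʸ p) b f g = sym (f p)
isYes-reflects (false because ofⁿ ¬p) true f g = ⊥-elim (¬p (g refl))
isYes-reflects (false because ofⁿ ¬p) false f g = refl

-- No test on rows: the rows of a self-dual matrix are nonzero as soon as its columns are.
inSplusᵇ : ∀ n → Matrix (suc n) → Bool
inSplusᵇ n M = utsdᵇ (suc n) M ∧ (colsNonzeroᵇ (suc n) M ∧ (entry M 0 n ℕ.≡ᵇ 1))

module _ {n : ℕ} (M : Matrix (suc n)) where
  private
    k = suc n

  upperTriangular⇒ℕ : UpperTriangular M → UpperTriangularℕ k M
  upperTriangular⇒ℕ ut =
    Fin²⇒ℕ² {Q = λ a b → b < a → entry M a b ≡ 0} (λ i j j<i → trans (entry-toℕ M i j) (ut i j j<i))

  upperTriangularℕ⇒ : UpperTriangularℕ k M → UpperTriangular M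
  upperTriangularℕ⇒ ut i j j<i = trans (sym (entry-toℕ M i j)) (ut _ _ (Finₚ.toℕ<n i) (Finₚ.toℕ<n j) j<i)

  selfDual⇒ℕ : SelfDual M → SelfDualℕ k M
  selfDual⇒ℕ sd = Fin²⇒ℕ² {Q = λ a b → entry M a b ≡ entry M (k ∸ suc b) (k ∸ suc a)} λ i j → begin
    entry M (toℕ i) (toℕ j)                         ≡⟨ entry-toℕ M i j ⟩
    M i j                                           ≡⟨ sd i j ⟩
    M (opposite j) (opposite i)                     ≡⟨ entry-toℕ M (opposite j) (opposite i) ⟨
    entry M (toℕ (opposite j)) (toℕ (opposite i))
      ≡⟨ cong₂ (entry M) (Finₚ.opposite-prop j) (Finₚ.opposite-prop i) ⟩
    entry M (k ∸ suc (toℕ j)) (k ∸ suc (toℕ i))     ∎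
    where open ≡-Reasoning

  selfDualℕ⇒ : SelfDualℕ k M → SelfDual M
  selfDualℕ⇒ sd i j = begin
    M i j                                           ≡⟨ entry-toℕ M i j ⟨
    entry M (toℕ i) (toℕ j)                         ≡⟨ sd _ _ (Finₚ.toℕ<n i) (Finₚ.toℕ<n j) ⟩
    entry M (k ∸ suc (toℕ j)) (k ∸ suc (toℕ i))
      ≡⟨ cong₂ (entry M) (Finₚ.opposite-prop j) (Finₚ.opposite-prop i) ⟨
    entry M (toℕ (opposite j)) (toℕ (opposite i))   ≡⟨ entry-toℕ M (opposite j) (opposite i) ⟩
    M (opposite j) (opposite i)                     ∎
    where open ≡-Reasoning

  colsNonzero⇒ℕ : ColsNonzero M → ∀ b → b < k → ¬ (colSum k M b ≡ 0)
  colsNonzero⇒ℕ cols b b<k with cols (fromℕ< b<k)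
  ... | i , Mib≢0 = ∃≢0⇒Σ<≢0 k (λ a → entry M a b) (toℕ i) (Finₚ.toℕ<n i) λ e →
    Mib≢0 (trans (sym (entry-toℕ M i (fromℕ< b<k))) (trans (cong (entry M (toℕ i)) (Finₚ.toℕ-fromℕ< b<k)) e))

  colsNonzeroℕ⇒ : (∀ b → b < k → ¬ (colSum k M b ≡ 0)) → ColsNonzero M
  colsNonzeroℕ⇒ cols j with Σ<≢0⇒∃≢0 k (λ a → entry M a (toℕ j)) (cols (toℕ j) (Finₚ.toℕ<n j))
  ... | a , a<k , Maj≢0 = fromℕ< a<k , λ e →
    Maj≢0 (trans (cong (λ t → entry M t (toℕ j)) (sym (Finₚ.toℕ-fromℕ< a<k)))
                 (trans (entry-toℕ M (fromℕ< a<k) j) e))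

  selfDual∧colsNonzero⇒rowsNonzero : SelfDual M → ColsNonzero M → RowsNonzero M
  selfDual∧colsNonzero⇒rowsNonzero sd cols i with cols (opposite i)
  ... | i′ , ne = opposite i′ , λ e →
    ne (trans (sd i′ (opposite i)) (trans (cong (λ t → M t (opposite i′)) (Finₚ.opposite-involutive i)) e))

  cornerOne⇒ℕ : CornerOne M → entry M 0 n ≡ 1
  cornerOne⇒ℕ c = trans (cong (entry M 0) (sym (Finₚ.toℕ-fromℕ n))) (trans (entry-toℕ M fz (fromℕ n)) c)

  cornerOneℕ⇒ : entry M 0 n ≡ 1 → CornerOne M
  cornerOneℕ⇒ c = trans (sym (entry-toℕ M fz (fromℕ n))) (trans (cong (entry M 0) (Finₚ.toℕ-fromℕ n)) c)

  isYes-InSplus? : BitMatrix M → ⌊ InSplus? M ⌋ ≡ inSplusᵇ n M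
  isYes-InSplus? bits-M = isYes-reflects (InSplus? M) (inSplusᵇ n M) sound complete
    where
    sound : InSplus M → inSplusᵇ n M ≡ true
    sound ((ut , _ , cols) , _ , sd , corner) = ∧≡true⁺
      (utsdᵇ-complete k M (upperTriangular⇒ℕ ut , selfDual⇒ℕ sd))
      (∧≡true⁺ (allᵇ-complete k _ (λ b b<k → not≡ᵇ0-complete _ (colsNonzero⇒ℕ cols b b<k)))
               (≡ᵇ-complete _ _ (cornerOne⇒ℕ corner)))
    complete : inSplusᵇ n M ≡ true → InSplus M
    complete h with ∧≡true⁻ {utsdᵇ k M} h
    ... | utsd , rest with ∧≡true⁻ {colsNonzeroᵇ k M} rest | utsdᵇ-sound k M utsd
    ... | cols , corner | ut , sd =
      let colsM = colsNonzeroℕ⇒ λ b b<k →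
                    not≡ᵇ0-sound _ (allᵇ-sound k (λ b → not (colSum k M b ℕ.≡ᵇ 0)) cols b b<k) in
      (upperTriangularℕ⇒ ut , selfDual∧colsNonzero⇒rowsNonzero (selfDualℕ⇒ sd) colsM , colsM)
      , bits-M , selfDualℕ⇒ sd , cornerOneℕ⇒ (≡ᵇ-sound _ _ corner)

-- Gluing a corner, a first row and an inner matrix

∸-suc : ∀ m b → b < m → m ∸ b ≡ suc (m ∸ suc b)
∸-suc (suc m) b (s≤s b≤m) = ℕₚ.+-∸-assoc 1 b≤m

∸-suc-< : ∀ m a → a < m → m ∸ suc a < m
∸-suc-< (suc m) a _ = s≤s (ℕₚ.m∸n≤m m a)

module Glue (m : ℕ) where
  K : ℕ
  K = suc (suc m)

  -- Row 0 is the first row s followed by the corner c; below it, column K - 1 is s read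
  -- backwards (self-duality) and the remaining block is I shifted by one row and one column.
  glueℕ : ℕ → (Fin (suc m) → ℕ) → Matrix m → ℕ → ℕ → ℕ
  glueℕ c s I zero b = if b ℕ.≡ᵇ suc m then c else extend s b
  glueℕ c s I (suc a) zero = 0
  glueℕ c s I (suc a) (suc b) = if b ℕ.≡ᵇ m then extend s (m ∸ a) else entry I a b

  glue : ℕ → (Fin (suc m) → ℕ) → Matrix m → Matrix K
  glue c s I i j = glueℕ c s I (toℕ i) (toℕ j)

  entry-glue : ∀ c s I a b → a < K → b < K → entry (glue c s I) a b ≡ glueℕ c s I a b
  entry-glue c s I a b = entry-tabulate K (glueℕ c s I) a b

  glueℕ-cong : ∀ {c c′ s s′ I I′} → c ≡ c′ → (∀ j → s j ≡ s′ j) → I ≈ᴹ I′ →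
               ∀ a b → glueℕ c s I a b ≡ glueℕ c′ s′ I′ a b
  glueℕ-cong c≡c′ s≈s′ I≈I′ zero b = cong₂ (if b ℕ.≡ᵇ suc m then_else_) c≡c′ (extend-cong s≈s′ b)
  glueℕ-cong c≡c′ s≈s′ I≈I′ (suc a) zero = refl
  glueℕ-cong c≡c′ s≈s′ I≈I′ (suc a) (suc b) =
    cong₂ (if b ℕ.≡ᵇ m then_else_) (extend-cong s≈s′ (m ∸ a)) (entry-cong I≈I′ a b)

  module _ (c : ℕ) (s : Fin (suc m) → ℕ) (I : Matrix m) where
    glue-corner : glueℕ c s I 0 (suc m) ≡ c
    glue-corner rewrite ≡ᵇ-refl m = refl

    glue-lastCol : ∀ a → glueℕ c s I (suc a) (suc m) ≡ extend s (m ∸ a)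
    glue-lastCol a rewrite ≡ᵇ-refl m = refl

    glue-topRow : ∀ b → b ≤ m → glueℕ c s I 0 b ≡ extend s b
    glue-topRow b b≤m rewrite <⇒≡ᵇ-false b (suc m) (s≤s b≤m) = refl

    glue-inner : ∀ a b → b < m → glueℕ c s I (suc a) (suc b) ≡ entry I a b
    glue-inner a b b<m rewrite <⇒≡ᵇ-false b m b<m = refl

    glue-lastRow : ∀ b → b ≤ m → glueℕ c s I (suc m) b ≡ 0
    glue-lastRow zero _ = refl
    glue-lastRow (suc b) b<m = trans (glue-inner m b b<m) (entry-≥-row I m b ℕₚ.≤-refl)

    glue-Bit : Bit c → (∀ j → Bit (s j)) → BitMatrix I → BitMatrix (glue c s I)
    glue-Bit bit-c bits-s bits-I i j = bit (toℕ i) (toℕ j)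
      where
      bit : ∀ a b → Bit (glueℕ c s I a b)
      bit zero b = Bit-if (b ℕ.≡ᵇ suc m) bit-c (extend-Bit s bits-s b)
      bit (suc a) zero = inj₁ refl
      bit (suc a) (suc b) = Bit-if (b ℕ.≡ᵇ m) (extend-Bit s bits-s (m ∸ a)) (entry-Bit I bits-I a b)

  Pieces : Set
  Pieces = ℕ × (Fin (suc m) → ℕ) × Matrix m

  piecesSetoid : DecSetoid 0ℓ 0ℓ
  piecesSetoid = ×-decSetoid ℕₚ.≡-decSetoid (×-decSetoid (rowSetoid (suc m)) (matrixSetoid m))

  open DecSetoid piecesSetoid using () renaming (_≈_ to _≈ᴾ_)

  glue′ : Pieces → Matrix K
  glue′ (c , s , I) = glue c s I

  cornerOf : Matrix K → ℕ
  cornerOf M = entry M 0 (suc m)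

  topRowOf : Matrix K → Fin (suc m) → ℕ
  topRowOf M j = entry M 0 (toℕ j)

  innerOf : Matrix K → Matrix m
  innerOf M i j = entry M (suc (toℕ i)) (suc (toℕ j))

  unglue : Matrix K → Pieces
  unglue M = cornerOf M , topRowOf M , innerOf M

  glue′-cong : ∀ {x y} → x ≈ᴾ y → glue′ x ≈ᴹ glue′ y
  glue′-cong (c≡c′ , s≈s′ , I≈I′) i j = glueℕ-cong c≡c′ s≈s′ I≈I′ (toℕ i) (toℕ j)

  unglue-cong : ∀ {M N} → M ≈ᴹ N → unglue M ≈ᴾ unglue N
  unglue-cong M≈N = entry-cong M≈N 0 (suc m) , (λ j → entry-cong M≈N 0 (toℕ j))
                  , (λ i j → entry-cong M≈N (suc (toℕ i)) (suc (toℕ j)))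

  unglue-glue : ∀ c s I → unglue (glue c s I) ≈ᴾ (c , s , I)
  unglue-glue c s I =
      trans (entry-glue c s I 0 (suc m) (s≤s z≤n) ℕₚ.≤-refl) (glue-corner c s I)
    , (λ j → trans (entry-glue c s I 0 (toℕ j) (s≤s z≤n) (ℕₚ.m≤n⇒m≤1+n (Finₚ.toℕ<n j)))
                   (trans (glue-topRow c s I (toℕ j) (s≤s⁻¹ (Finₚ.toℕ<n j))) (extend-toℕ s j)))
    , (λ i j → trans (entry-glue c s I (suc (toℕ i)) (suc (toℕ j)) (inner< i) (inner< j))
                     (trans (glue-inner c s I (toℕ i) (toℕ j) (Finₚ.toℕ<n j)) (entry-toℕ I i j)))
    where
    inner< : ∀ (i : Fin m) → suc (toℕ i) < K
    inner< i = s≤s (ℕₚ.m≤n⇒m≤1+n (Finₚ.toℕ<n i))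

  entry-glue-unglue : ∀ M → UpperTriangularℕ K M → SelfDualℕ K M →
                      ∀ a b → a < K → b < K → entry M a b ≡ glueℕ (cornerOf M) (topRowOf M) (innerOf M) a b
  entry-glue-unglue M ut sd zero b p q with b ℕ.≡ᵇ suc m in e
  ... | true = cong (entry M 0) (≡ᵇ-sound b (suc m) e)
  ... | false =
    sym (extend-tabulate (suc m) (entry M 0) b (ℕₚ.≤∧≢⇒< (s≤s⁻¹ q) (≡ᵇ-false⇒≢ b (suc m) e)))
  entry-glue-unglue M ut sd (suc a) zero p q = ut (suc a) 0 p q (s≤s z≤n)
  entry-glue-unglue M ut sd (suc a) (suc b) p q with b ℕ.≡ᵇ m in e
  ... | true with ≡ᵇ-sound b m e
  ...   | refl = trans (sd (suc a) (suc m) p q)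
                (trans (cong (λ t → entry M t (m ∸ a)) (ℕₚ.n∸n≡0 m))
                (sym (extend-tabulate (suc m) (entry M 0) (m ∸ a) (s≤s (ℕₚ.m∸n≤m m a)))))
  entry-glue-unglue M ut sd (suc a) (suc b) p q | false with a ℕ.<? m
  ... | yes a<m = sym (entry-tabulate m (λ x y → entry M (suc x) (suc y)) a b a<m b<m)
    where b<m = ℕₚ.≤∧≢⇒< (s≤s⁻¹ (s≤s⁻¹ q)) (≡ᵇ-false⇒≢ b m e)
  ... | no a≮m = trans (ut (suc a) (suc b) p q (s≤s (ℕₚ.<-≤-trans b<m (ℕₚ.≮⇒≥ a≮m))))
                       (sym (entry-≥-row (innerOf M) a b (ℕₚ.≮⇒≥ a≮m)))
    where b<m = ℕₚ.≤∧≢⇒< (s≤s⁻¹ (s≤s⁻¹ q)) (≡ᵇ-false⇒≢ b m e)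

  glue-unglue : ∀ M → UpperTriangularℕ K M → SelfDualℕ K M → M ≈ᴹ glue′ (unglue M)
  glue-unglue M ut sd i j =
    trans (sym (entry-toℕ M i j)) (entry-glue-unglue M ut sd (toℕ i) (toℕ j) (Finₚ.toℕ<n i) (Finₚ.toℕ<n j))

  opposite-< : ∀ x → K ∸ suc x < K
  opposite-< x = s≤s (ℕₚ.m∸n≤m (suc m) x)

  module _ (c : ℕ) (s : Fin (suc m) → ℕ) (I : Matrix m) where
    glue-upperTriangular : UpperTriangularℕ m I → UpperTriangularℕ K (glue c s I)
    glue-upperTriangular ut a b p q b<a = trans (entry-glue c s I a b p q) (lower a b p q b<a)
      where
      lower : ∀ a b → a < K → b < K → b < a → glueℕ c s I a b ≡ 0
      lower (suc a) zero p q b<a = refl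
      lower (suc a) (suc b) p q (s≤s b<a) with b ℕ.≡ᵇ m in e
      ... | true = ⊥-elim (ℕₚ.<-irrefl (≡ᵇ-sound b m e) (ℕₚ.<-≤-trans b<a (s≤s⁻¹ (s≤s⁻¹ p))))
      ... | false with a ℕ.<? m
      ...   | yes a<m = ut a b a<m (ℕₚ.<-trans b<a a<m) b<a
      ...   | no a≮m = entry-≥-row I a b (ℕₚ.≮⇒≥ a≮m)

    glueℕ-selfDual : SelfDualℕ m I → ∀ a b → a < K → b < K →
                     glueℕ c s I a b ≡ glueℕ c s I (K ∸ suc b) (K ∸ suc a)
    glueℕ-selfDual sd zero b p q with b ℕ.≡ᵇ suc m in e
    ... | true with ≡ᵇ-sound b (suc m) e
    ...   | refl = sym (trans (cong (λ t → glueℕ c s I t (suc m)) (ℕₚ.n∸n≡0 m)) (glue-corner c s I))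
    glueℕ-selfDual sd zero b p q | false =
      let b≤m = s≤s⁻¹ (ℕₚ.≤∧≢⇒< (s≤s⁻¹ q) (≡ᵇ-false⇒≢ b (suc m) e)) in
      sym (trans (cong (λ t → glueℕ c s I t (suc m)) (ℕₚ.+-∸-assoc 1 b≤m))
          (trans (glue-lastCol c s I (m ∸ b)) (cong (extend s) (ℕₚ.m∸[m∸n]≡n b≤m))))
    glueℕ-selfDual sd (suc a) zero p q = sym (glue-lastRow c s I (m ∸ a) (ℕₚ.m∸n≤m m a))
    glueℕ-selfDual sd (suc a) (suc b) p q with b ℕ.≡ᵇ m in e
    ... | true with ≡ᵇ-sound b m e
    ...   | refl =
      sym (trans (cong (λ t → glueℕ c s I t (m ∸ a)) (ℕₚ.n∸n≡0 m))
                 (glue-topRow c s I (m ∸ a) (ℕₚ.m∸n≤m m a)))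
    glueℕ-selfDual sd (suc a) (suc b) p q | false with a ℕ.<? m
    ... | yes a<m =
      trans (sd a b a<m b<m)
      (sym (trans (cong₂ (glueℕ c s I) (∸-suc m b b<m) (∸-suc m a a<m))
           (glue-inner c s I (m ∸ suc b) (m ∸ suc a) (∸-suc-< m a a<m))))
      where b<m = ℕₚ.≤∧≢⇒< (s≤s⁻¹ (s≤s⁻¹ q)) (≡ᵇ-false⇒≢ b m e)
    ... | no a≮m =
      trans (entry-≥-row I a b (ℕₚ.≮⇒≥ a≮m))
      (sym (cong₂ (glueℕ c s I) (∸-suc m b b<m) (trans (cong (m ∸_) a≡m) (ℕₚ.n∸n≡0 m))))
      where
      b<m = ℕₚ.≤∧≢⇒< (s≤s⁻¹ (s≤s⁻¹ q)) (≡ᵇ-false⇒≢ b m e)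
      a≡m = ℕₚ.≤-antisym (s≤s⁻¹ (s≤s⁻¹ p)) (ℕₚ.≮⇒≥ a≮m)

    glue-selfDual : SelfDualℕ m I → SelfDualℕ K (glue c s I)
    glue-selfDual sd a b p q =
      trans (entry-glue c s I a b p q)
      (trans (glueℕ-selfDual sd a b p q) (sym (entry-glue c s I _ _ (opposite-< b) (opposite-< a))))

    private
      inner<K : ∀ {a} → a < m → suc a < K
      inner<K a<m = s≤s (ℕₚ.m≤n⇒m≤1+n a<m)

      entry-inner : ∀ a b → a < m → b < m → entry I a b ≡ entry (glue c s I) (suc a) (suc b)
      entry-inner a b p q = sym (trans (entry-glue c s I (suc a) (suc b) (inner<K p) (inner<K q)) (glue-inner c s I a b q))

    inner-upperTriangular : UpperTriangularℕ K (glue c s I) → UpperTriangularℕ m I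
    inner-upperTriangular ut a b p q b<a = trans (entry-inner a b p q) (ut (suc a) (suc b) (inner<K p) (inner<K q) (s≤s b<a))

    inner-selfDual : SelfDualℕ K (glue c s I) → SelfDualℕ m I
    inner-selfDual sd a b p q =
      trans (entry-inner a b p q)
      (trans (sd (suc a) (suc b) (inner<K p) (inner<K q))
      (trans (entry-glue c s I (m ∸ b) (m ∸ a) (opposite-< (suc b)) (opposite-< (suc a)))
      (trans (cong₂ (glueℕ c s I) (∸-suc m b q) (∸-suc m a p))
             (glue-inner c s I (m ∸ suc b) (m ∸ suc a) (∸-suc-< m a p)))))

    utsdᵇ-glue : utsdᵇ K (glue c s I) ≡ utsdᵇ m I
    utsdᵇ-glue = Bool-≡
      (λ h → let (ut , sd) = utsdᵇ-sound K (glue c s I) h in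
             utsdᵇ-complete m I (inner-upperTriangular ut , inner-selfDual sd))
      (λ h → let (ut , sd) = utsdᵇ-sound m I h in
             utsdᵇ-complete K (glue c s I) (glue-upperTriangular ut , glue-selfDual sd))

  topRows : List (Fin (suc m) → ℕ)
  topRows = allFuns (suc m) bits

  allPieces : List Pieces
  allPieces = cartesianProduct bits (cartesianProduct topRows (all01Matrices m))

  ∑-allPieces : ∀ G →
    ∑ allPieces G ≡ ∑ bits (λ c → ∑ topRows (λ s → ∑ (all01Matrices m) (λ I → G (c , s , I))))
  ∑-allPieces G = trans (∑-cartesianProduct bits (cartesianProduct topRows (all01Matrices m)) G)
                        (∑-cong bits (λ c → ∑-cartesianProduct topRows (all01Matrices m) (λ p → G (c , p))))

  BitPieces : Pieces → Set
  BitPieces (c , s , I) = Bit c × (∀ j → Bit (s j)) × BitMatrix I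

  allPieces-Bit : All BitPieces allPieces
  allPieces-Bit = All.map (λ { (bit-c , bits-s , bits-I) → bit-c , bits-s , bits-I })
    (cartesianProduct-All bits-Bit (cartesianProduct-All (allFuns-All (suc m) bits bits-Bit) (all01Matrices-Bit m)))

  count-allPieces : ∀ M → BitMatrix M → count piecesSetoid allPieces (unglue M) ≡ + 1
  count-allPieces M bits-M = begin
    count piecesSetoid allPieces (unglue M)
      ≡⟨ count-cartesianProduct ℕₛ rowsAndInners bits rest (cornerOf M) (topRowOf M , innerOf M) ⟩
    count ℕₛ bits (cornerOf M) * count rowsAndInners rest (topRowOf M , innerOf M)
      ≡⟨ cong (count ℕₛ bits (cornerOf M) *_) (count-cartesianProduct (rowSetoid (suc m)) (matrixSetoid m)
                                                  topRows (all01Matrices m) (topRowOf M) (innerOf M)) ⟩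
    count ℕₛ bits (cornerOf M)
      * (count (rowSetoid (suc m)) topRows (topRowOf M) * count (matrixSetoid m) (all01Matrices m) (innerOf M))
      ≡⟨ cong₂ _*_ (count-bits _ (entry-Bit M bits-M 0 (suc m)))
          (cong₂ _*_ (count-allFuns ℕₛ bits count-bits (suc m) (topRowOf M) (λ j → entry-Bit M bits-M 0 (toℕ j)))
                     (count-all01Matrices m (innerOf M) (λ i j → entry-Bit M bits-M (suc (toℕ i)) (suc (toℕ j))))) ⟩
    + 1 ∎
    where
    open ≡-Reasoning
    ℕₛ rowsAndInners : DecSetoid 0ℓ 0ℓ
    ℕₛ = ℕₚ.≡-decSetoid
    rowsAndInners = ×-decSetoid (rowSetoid (suc m)) (matrixSetoid m)
    rest : List ((Fin (suc m) → ℕ) × Matrix m)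
    rest = cartesianProduct topRows (all01Matrices m)

  count-glue : ∀ x → BitPieces x → count (matrixSetoid K) (all01Matrices K) (glue′ x) ≡ + 1
  count-glue (c , s , I) (bit-c , bits-s , bits-I) = count-all01Matrices K _ (glue-Bit c s I bit-c bits-s bits-I)

  ∑-utsd-glue : (H : Matrix K → ℤ) → (∀ {M N} → M ≈ᴹ N → H M ≡ H N) →
    ∑ (all01Matrices K) (λ M → 𝟙 (utsdᵇ K M) * H M) ≡
    ∑ bits (λ c → ∑ topRows (λ s → ∑ (all01Matrices m) (λ I → 𝟙 (utsdᵇ m I) * H (glue c s I))))
  ∑-utsd-glue H H-cong =
    trans (∑-reindex (matrixSetoid K) piecesSetoid glue′ unglue glue′-cong unglue-cong F F-cong
                     (all01Matrices K) allPieces (all01Matrices-Bit K) allPieces-Bit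
                     count-allPieces count-glue supported (λ x _ → unglue-glue _ _ _))
    (trans (∑-allPieces _)
    (∑-cong bits (λ c → ∑-cong topRows (λ s → ∑-cong (all01Matrices m) (λ I →
       cong (λ t → 𝟙 t * H (glue c s I)) (utsdᵇ-glue c s I))))))
    where
    F : Matrix K → ℤ
    F M = 𝟙 (utsdᵇ K M) * H M
    F-cong : ∀ {M N} → M ≈ᴹ N → F M ≡ F N
    F-cong M≈N = cong₂ (λ t u → 𝟙 t * u) (utsdᵇ-cong K M≈N) (H-cong M≈N)
    supported : ∀ M → BitMatrix M → F M ≡ + 0 ⊎ M ≈ᴹ glue′ (unglue M)
    supported M _ with utsdᵇ K M in e
    ... | false = inj₁ refl
    ... | true = let (ut , sd) = utsdᵇ-sound K M e in inj₂ (glue-unglue M ut sd)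

-- Statistics of a glued matrix

masked : (ℕ → ℕ → Bool) → ℕ → ℕ → ℕ → ℕ
masked q a b x = if q a b then x else 0

masked-false : ∀ q a b x → q a b ≡ false → masked q a b x ≡ 0
masked-false q a b x qab≡false rewrite qab≡false = refl

masked-true : ∀ q a b x → q a b ≡ true → masked q a b x ≡ x
masked-true q a b x qab≡true rewrite qab≡true = refl

masked-zero : ∀ q a b → masked q a b 0 ≡ 0
masked-zero q a b with q a b
... | true = refl
... | false = refl

seCell : ℕ → ℕ → ℕ → Bool
seCell k a b = k ℕ.≤ᵇ a ℕ.+ b

diagonalCell : ℕ → ℕ → ℕ → Bool
diagonalCell k a b = suc (a ℕ.+ b) ℕ.≡ᵇ k

-- Unlike seStat and dgStat, these statistics include the last column and the corner.
seAll : ∀ k → Matrix k → ℕ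
seAll k M = Σ<² k (λ a b → masked (seCell k) a b (entry M a b))

dgAll : ∀ k → Matrix k → ℕ
dgAll k M = Σ<² k (λ a b → masked (diagonalCell k) a b (entry M a b))

-- Column b - 1 of an inner matrix lies in column b of the glued matrix.
colSum′ : ∀ k → Matrix k → ℕ → ℕ
colSum′ k M zero = 0
colSum′ k M (suc b) = colSum k M b

seAll-cong : ∀ k {M N : Matrix k} → M ≈ᴹ N → seAll k M ≡ seAll k N
seAll-cong k M≈N = Σ<-cong k (λ a → Σ<-cong k (λ b → cong (masked (seCell k) a b) (entry-cong M≈N a b)))

dgAll-cong : ∀ k {M N : Matrix k} → M ≈ᴹ N → dgAll k M ≡ dgAll k N
dgAll-cong k M≈N = Σ<-cong k (λ a → Σ<-cong k (λ b → cong (masked (diagonalCell k) a b) (entry-cong M≈N a b)))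

colSum′-cong : ∀ k {M N : Matrix k} → M ≈ᴹ N → ∀ b → colSum′ k M b ≡ colSum′ k N b
colSum′-cong k M≈N zero = refl
colSum′-cong k M≈N (suc b) = colSum-cong k M≈N b

<ᵇ-suc : ∀ a x → (a ℕ.<ᵇ suc x) ≡ (a ℕ.≤ᵇ x)
<ᵇ-suc zero x = refl
<ᵇ-suc (suc a) x = refl

<ᵇ-+-suc : ∀ m a b → (m ℕ.<ᵇ a ℕ.+ suc b) ≡ (m ℕ.≤ᵇ a ℕ.+ b)
<ᵇ-+-suc m a b = trans (cong (m ℕ.<ᵇ_) (ℕₚ.+-suc a b)) (<ᵇ-suc m (a ℕ.+ b))

≡ᵇ-+-suc : ∀ m a b → (a ℕ.+ suc b ℕ.≡ᵇ m) ≡ (suc (a ℕ.+ b) ℕ.≡ᵇ m)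
≡ᵇ-+-suc m a b = cong (ℕ._≡ᵇ m) (ℕₚ.+-suc a b)

>⇒≤ᵇ-false : ∀ a b → b < a → (a ℕ.≤ᵇ b) ≡ false
>⇒≤ᵇ-false (suc a) zero _ = refl
>⇒≤ᵇ-false (suc a) (suc b) (s≤s b<a) = trans (<ᵇ-suc a b) (>⇒≤ᵇ-false a b b<a)

≥⇒<ᵇ-false : ∀ a b → b ≤ a → (a ℕ.<ᵇ b) ≡ false
≥⇒<ᵇ-false a zero _ = refl
≥⇒<ᵇ-false (suc a) (suc b) (s≤s b≤a) = ≥⇒<ᵇ-false a b b≤a

<+suc : ∀ m a → m < a ℕ.+ suc m
<+suc m a = ℕₚ.<-≤-trans (ℕₚ.n<1+n m) (ℕₚ.m≤n+m (suc m) a)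

+-suc-≡ᵇ-false : ∀ m a → (a ℕ.+ suc m ℕ.≡ᵇ m) ≡ false
+-suc-≡ᵇ-false m a = ≢⇒≡ᵇ-false (a ℕ.+ suc m) m (λ e → ℕₚ.<-irrefl (sym e) (<+suc m a))

rowSum : ∀ {n} → (Fin n → ℕ) → ℕ
rowSum {n} s = Σ< n (extend s)

module GlueStats (m : ℕ) (c : ℕ) (s : Fin (suc m) → ℕ) (I : Matrix m) where
  open Glue m

  private
    M : Matrix K
    M = glue c s I

  -- The last column, read bottom-up, is s again; the first column and the last row vanish.
  masked-glue : ∀ q {top corner inner last} →
    Σ< (suc m) (λ b → masked q 0 b (extend s b)) ≡ top →
    masked q 0 (suc m) c ≡ corner →
    Σ<² m (λ a b → masked q (suc a) (suc b) (entry I a b)) ≡ inner →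
    Σ< (suc m) (λ a → masked q (suc a) (suc m) (extend s (m ∸ a))) ≡ last →
    Σ<² K (λ a b → masked q a b (entry M a b)) ≡ (top ℕ.+ corner) ℕ.+ (inner ℕ.+ last)
  masked-glue q {top} {corner} {inner} {last} top≡ corner≡ inner≡ last≡ = begin
    Σ<² K (λ a b → masked q a b (entry M a b))
      ≡⟨ Σ<-cong-< K (λ a p → Σ<-cong-< K (λ b r → cong (masked q a b) (entry-glue c s I a b p r))) ⟩
    Σ< K (λ b → masked q 0 b (glueℕ c s I 0 b)) ℕ.+ Σ< (suc m) (λ a → Σ< K (λ b → Q (suc a) b))
      ≡⟨ cong₂ ℕ._+_ firstRow (trans (Σ<-cong (suc m) row) (Σ<-+ (suc m) X Y)) ⟩
    (firstRowSum ℕ.+ masked q 0 (suc m) c) ℕ.+ (Σ< (suc m) X ℕ.+ Σ< (suc m) Y)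
      ≡⟨ cong (λ t → (firstRowSum ℕ.+ masked q 0 (suc m) c) ℕ.+ (t ℕ.+ Σ< (suc m) Y))
              (trans (Σ<-snoc m X) (trans (cong (Σ< m X ℕ.+_) lastRow) (ℕₚ.+-identityʳ (Σ< m X)))) ⟩
    (firstRowSum ℕ.+ masked q 0 (suc m) c) ℕ.+ (Σ< m X ℕ.+ Σ< (suc m) Y)
      ≡⟨ cong₂ ℕ._+_ (cong₂ ℕ._+_ top≡ corner≡) (cong₂ ℕ._+_ inner≡ last≡) ⟩
    (top ℕ.+ corner) ℕ.+ (inner ℕ.+ last) ∎
    where
    open ≡-Reasoning
    Q : ℕ → ℕ → ℕ
    Q a b = masked q a b (glueℕ c s I a b)
    firstRowSum : ℕ
    firstRowSum = Σ< (suc m) (λ b → masked q 0 b (extend s b))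
    X Y : ℕ → ℕ
    X a = Σ< m (λ b → masked q (suc a) (suc b) (entry I a b))
    Y a = masked q (suc a) (suc m) (extend s (m ∸ a))
    firstRow : Σ< K (Q 0) ≡ firstRowSum ℕ.+ masked q 0 (suc m) c
    firstRow = trans (Σ<-snoc (suc m) (Q 0))
      (cong₂ ℕ._+_ (Σ<-cong-< (suc m) (λ b p → cong (masked q 0 b) (glue-topRow c s I b (s≤s⁻¹ p))))
                   (cong (masked q 0 (suc m)) (glue-corner c s I)))
    row : ∀ a → Σ< K (Q (suc a)) ≡ X a ℕ.+ Y a
    row a = trans (Σ<-split-ends m (Q (suc a)))
      (trans (cong (ℕ._+ (Σ< m (λ b → Q (suc a) (suc b)) ℕ.+ Q (suc a) (suc m))) (masked-zero q (suc a) 0))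
      (cong₂ ℕ._+_ (Σ<-cong-< m (λ b p → cong (masked q (suc a) (suc b)) (glue-inner c s I a b p)))
                   (cong (masked q (suc a) (suc m)) (glue-lastCol c s I a))))
    lastRow : X m ≡ 0
    lastRow = Σ<-zero m (λ b _ → trans (cong (masked q (suc m) (suc b)) (entry-≥-row I m b ℕₚ.≤-refl))
                                       (masked-zero q (suc m) (suc b)))

  lastCol≡rowSum : ∀ q → (∀ a → q (suc a) (suc m) ≡ true) →
                   Σ< (suc m) (λ a → masked q (suc a) (suc m) (extend s (m ∸ a))) ≡ rowSum s
  lastCol≡rowSum q q≡true =
    trans (Σ<-cong (suc m) (λ a → masked-true q (suc a) (suc m) (extend s (m ∸ a)) (q≡true a)))
          (Σ<-reverse (suc m) (extend s))

  maxStat-glue : maxStat M ≡ rowSum s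
  maxStat-glue = trans (cellSum-Σ< M _ q (λ i j → refl)) (masked-glue q
    (Σ<-zero (suc m) (λ b _ → masked-false q 0 b (extend s b) (Boolₚ.∧-zeroʳ (b ℕ.≡ᵇ suc m))))
    (masked-false q 0 (suc m) c (Boolₚ.∧-zeroʳ (suc m ℕ.≡ᵇ suc m)))
    (Σ<-zero m (λ a _ → Σ<-zero m (λ b b<m → masked-false q (suc a) (suc b) (entry I a b)
                                                 (cong (_∧ true) (<⇒≡ᵇ-false b m b<m)))))
    (lastCol≡rowSum q (λ a → cong (_∧ true) (≡ᵇ-refl m))))
    where
    q : ℕ → ℕ → Bool
    q a b = (b ℕ.≡ᵇ suc m) ∧ not (a ℕ.≡ᵇ 0)

  seStat-glue : seStat M ≡ seAll m I
  seStat-glue = trans (cellSum-Σ< M _ q (λ i j → refl)) (trans (masked-glue q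
    (Σ<-zero (suc m) (λ b b<K → masked-false q 0 b (extend s b)
                                   (cong (_∧ not (b ℕ.≡ᵇ suc m)) (≥⇒<ᵇ-false (suc m) b (ℕₚ.<⇒≤ b<K)))))
    (masked-false q 0 (suc m) c (cong (_∧ not (m ℕ.≡ᵇ m)) (≥⇒<ᵇ-false (suc m) (suc m) ℕₚ.≤-refl)))
    (Σ<-cong m (λ a → Σ<-cong-< m (λ b b<m → cong (λ t → if t then entry I a b else 0)
       (trans (cong ((m ℕ.<ᵇ a ℕ.+ suc b) ∧_) (cong not (<⇒≡ᵇ-false b m b<m)))
              (trans (Boolₚ.∧-identityʳ _) (<ᵇ-+-suc m a b))))))
    (Σ<-zero (suc m) (λ a _ → masked-false q (suc a) (suc m) (extend s (m ∸ a))
       (trans (cong (λ t → (m ℕ.<ᵇ a ℕ.+ suc m) ∧ not t) (≡ᵇ-refl m)) (Boolₚ.∧-zeroʳ _)))))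
    (ℕₚ.+-identityʳ _))
    where
    q : ℕ → ℕ → Bool
    q a b = (suc m ℕ.<ᵇ a ℕ.+ b) ∧ not (b ℕ.≡ᵇ suc m)

  dgStat-glue : dgStat M ≡ dgAll m I
  dgStat-glue = trans (cellSum-Σ< M _ q (λ i j → refl)) (trans (masked-glue q
    (Σ<-zero (suc m) (λ b _ → masked-false q 0 b (extend s b) (Boolₚ.∧-zeroʳ _)))
    (masked-false q 0 (suc m) c (Boolₚ.∧-zeroʳ _))
    (Σ<-cong m (λ a → Σ<-cong m (λ b → cong (λ t → if t then entry I a b else 0)
       (trans (Boolₚ.∧-identityʳ _) (≡ᵇ-+-suc m a b)))))
    (Σ<-zero (suc m) (λ a _ → masked-false q (suc a) (suc m) (extend s (m ∸ a))
                                             (cong (_∧ true) (+-suc-≡ᵇ-false m a)))))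
    (ℕₚ.+-identityʳ _))
    where
    q : ℕ → ℕ → Bool
    q a b = (a ℕ.+ b ℕ.≡ᵇ suc m) ∧ not (a ℕ.≡ᵇ 0)

  seAll-glue : seAll K M ≡ seAll m I ℕ.+ rowSum s
  seAll-glue = masked-glue (seCell K)
    (Σ<-zero (suc m) (λ b b<K → masked-false (seCell K) 0 b (extend s b) (>⇒≤ᵇ-false K b (ℕₚ.m≤n⇒m≤1+n b<K))))
    (masked-false (seCell K) 0 (suc m) c (>⇒≤ᵇ-false K (suc m) ℕₚ.≤-refl))
    (Σ<-cong m (λ a → Σ<-cong m (λ b → cong (λ t → if t then entry I a b else 0) (<ᵇ-+-suc m a b))))
    (lastCol≡rowSum (seCell K) (λ a → <ᵇ-complete m (a ℕ.+ suc m) (<+suc m a)))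

  dgAll-glue : dgAll K M ≡ c ℕ.+ dgAll m I
  dgAll-glue = trans (masked-glue (diagonalCell K)
    (Σ<-zero (suc m) (λ b b<K → masked-false (diagonalCell K) 0 b (extend s b) (<⇒≡ᵇ-false b (suc m) b<K)))
    (masked-true (diagonalCell K) 0 (suc m) c (≡ᵇ-refl m))
    (Σ<-cong m (λ a → Σ<-cong m (λ b → cong (λ t → if t then entry I a b else 0) (≡ᵇ-+-suc m a b))))
    (Σ<-zero (suc m) (λ a _ → masked-false (diagonalCell K) (suc a) (suc m) (extend s (m ∸ a)) (+-suc-≡ᵇ-false m a))))
    (cong (c ℕ.+_) (ℕₚ.+-identityʳ _))

  colSum-glue : ∀ b → b ≤ m → colSum K M b ≡ extend s b ℕ.+ colSum′ m I b
  colSum-glue b b≤m =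
    trans (Σ<-cong-< K (λ a a<K → entry-glue c s I a b a<K (s≤s (ℕₚ.m≤n⇒m≤1+n b≤m)))) (column b b≤m)
    where
    column : ∀ b → b ≤ m → Σ< K (λ a → glueℕ c s I a b) ≡ extend s b ℕ.+ colSum′ m I b
    column zero _ = cong (extend s 0 ℕ.+_) (Σ<-zero (suc m) (λ _ _ → refl))
    column (suc b) b<m = cong₂ ℕ._+_ (glue-topRow c s I (suc b) b<m)
      (trans (Σ<-cong (suc m) (λ a → glue-inner c s I a b b<m))
      (trans (Σ<-snoc m (λ a → entry I a b))
      (trans (cong (colSum m I b ℕ.+_) (entry-≥-row I m b ℕₚ.≤-refl)) (ℕₚ.+-identityʳ _))))

  colSum-glue-last : colSum K M (suc m) ≡ c ℕ.+ rowSum s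
  colSum-glue-last = trans (Σ<-cong-< K (λ a a<K → entry-glue c s I a (suc m) a<K ℕₚ.≤-refl))
    (cong₂ ℕ._+_ (glue-corner c s I) (trans (Σ<-cong (suc m) (glue-lastCol c s I)) (Σ<-reverse (suc m) (extend s))))

-- Summing out the first row and the corner

weight : ∀ {n} → ℤ → ℤ → ℤ → Matrix (suc n) → ℤ
weight x w z M = x ^ maxStat M * w ^ seStat M * z ^ dgStat M

cellSum-cong : ∀ {k} {P : Fin k → Fin k → Set} {M N : Matrix k} (P? : ∀ i j → Dec (P i j)) →
               M ≈ᴹ N → cellSum M P? ≡ cellSum N P?
cellSum-cong {k} P? M≈N = cong sumℕ (Listₚ.map-cong (λ i → cong sumℕ (Listₚ.map-cong
  (λ j → cong (if ⌊ P? i j ⌋ then_else 0) (M≈N i j)) (allFin k))) (allFin k))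

weight-cong : ∀ {n} x w z {M N : Matrix (suc n)} → M ≈ᴹ N → weight x w z M ≡ weight x w z N
weight-cong x w z {M} {N} M≈N =
  cong₂ _*_ (cong₂ _*_ (cong (x ^_) maxStat≡) (cong (w ^_) seStat≡)) (cong (z ^_) dgStat≡)
  where
  maxStat≡ : maxStat M ≡ maxStat N
  maxStat≡ = cellSum-cong _ M≈N
  seStat≡ : seStat M ≡ seStat N
  seStat≡ = cellSum-cong _ M≈N
  dgStat≡ : dgStat M ≡ dgStat N
  dgStat≡ = cellSum-cong _ M≈N

columnFactor : ℤ → ℕ → ℤ
columnFactor x t = x + 𝟙 (not (t ℕ.≡ᵇ 0))

columnProduct : ℤ → ∀ k → Matrix k → ℤ
columnProduct x k I = ∏< (suc k) (λ j → columnFactor x (colSum′ k I j))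

innerWeight : ℤ → ℤ → ∀ k → Matrix k → ℤ
innerWeight w z k I = w ^ seAll k I * z ^ dgAll k I

reducedWeight : ∀ k → ℤ → ℤ → ℤ → Matrix k → ℤ
reducedWeight k x w z I = innerWeight w z k I * columnProduct x k I

reducedWeight-cong : ∀ k x w z {I J : Matrix k} → I ≈ᴹ J → reducedWeight k x w z I ≡ reducedWeight k x w z J
reducedWeight-cong k x w z I≈J =
  cong₂ _*_ (cong₂ _*_ (cong (w ^_) (seAll-cong k I≈J)) (cong (z ^_) (dgAll-cong k I≈J)))
            (∏<-cong (suc k) (λ j → cong (columnFactor x) (colSum′-cong k I≈J j)))

reducedTerm : ∀ k → ℤ → ℤ → ℤ → Matrix k → ℤ
reducedTerm k x w z I = 𝟙 (utsdᵇ k I) * reducedWeight k x w z I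

module Reduction (m : ℕ) (x w z : ℤ) where
  open Glue m

  H : Matrix K → ℤ
  H M = 𝟙 (colsNonzeroᵇ K M ∧ (entry M 0 (suc m) ℕ.≡ᵇ 1)) * weight x w z M

  H-cong : ∀ {M N} → M ≈ᴹ N → H M ≡ H N
  H-cong M≈N = cong₂ (λ t u → 𝟙 t * u)
    (cong₂ _∧_ (colsNonzeroᵇ-cong K M≈N) (cong (ℕ._≡ᵇ 1) (entry-cong M≈N 0 (suc m)))) (weight-cong x w z M≈N)

  Sgf≡∑-utsd : Sgf (suc m) x w z ≡ ∑ (all01Matrices K) (λ M → 𝟙 (utsdᵇ K M) * H M)
  Sgf≡∑-utsd =
    trans (foldr-+-map≡∑ (Splus (suc m)) (weight x w z))
    (trans (∑-filter InSplus? (all01Matrices K) (weight x w z))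
    (∑-cong-All (all01Matrices-Bit K) (λ M bits-M → begin
      𝟙? (InSplus? M) * weight x w z M
        ≡⟨ cong (λ t → 𝟙 t * weight x w z M) (trans (sym (isYes≡does (InSplus? M))) (isYes-InSplus? M bits-M)) ⟩
      𝟙 (utsdᵇ K M ∧ _) * weight x w z M
        ≡⟨ cong (_* weight x w z M) (𝟙-∧ (utsdᵇ K M) _) ⟩
      𝟙 (utsdᵇ K M) * 𝟙 (colsNonzeroᵇ K M ∧ _) * weight x w z M
        ≡⟨ ℤₚ.*-assoc (𝟙 (utsdᵇ K M)) _ (weight x w z M) ⟩
      𝟙 (utsdᵇ K M) * H M ∎)))
    where open ≡-Reasoning

  -- The columns of glue c s I other than the last are nonzero iff these tests succeed.
  innerColsNonzeroᵇ : (Fin (suc m) → ℕ) → Matrix m → Bool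
  innerColsNonzeroᵇ s I = allᵇ (suc m) (λ b → not (extend s b ℕ.+ colSum′ m I b ℕ.≡ᵇ 0))

  H-glue : ∀ c s I → H (glue c s I) ≡
    𝟙 ((innerColsNonzeroᵇ s I ∧ not (c ℕ.+ rowSum s ℕ.≡ᵇ 0)) ∧ (c ℕ.≡ᵇ 1))
      * (x ^ rowSum s * innerWeight w z m I)
  H-glue c s I = cong₂ (λ t u → 𝟙 t * u) (cong₂ _∧_ cols corner) weight-glue
    where
    open GlueStats m c s I
    cols : colsNonzeroᵇ K (glue c s I) ≡ innerColsNonzeroᵇ s I ∧ not (c ℕ.+ rowSum s ℕ.≡ᵇ 0)
    cols = trans (allᵇ-snoc (suc m) (λ b → not (colSum K (glue c s I) b ℕ.≡ᵇ 0)))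
      (cong₂ _∧_ (allᵇ-cong (suc m) (λ b b<K → cong (λ t → not (t ℕ.≡ᵇ 0)) (colSum-glue b (s≤s⁻¹ b<K))))
                 (cong (λ t → not (t ℕ.≡ᵇ 0)) colSum-glue-last))
    corner : (entry (glue c s I) 0 (suc m) ℕ.≡ᵇ 1) ≡ (c ℕ.≡ᵇ 1)
    corner = cong (ℕ._≡ᵇ 1) (trans (entry-glue c s I 0 (suc m) (s≤s z≤n) ℕₚ.≤-refl) (glue-corner c s I))
    weight-glue : weight x w z (glue c s I) ≡ x ^ rowSum s * innerWeight w z m I
    weight-glue rewrite maxStat-glue | seStat-glue | dgStat-glue = ℤₚ.*-assoc (x ^ rowSum s) _ _

  term : ℕ → (Fin (suc m) → ℕ) → Matrix m → ℤ
  term c s I = 𝟙 (utsdᵇ m I) * H (glue c s I)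

  term-0 : ∀ s I → term 0 s I ≡ + 0
  term-0 s I = trans (cong (𝟙 (utsdᵇ m I) *_) (trans (H-glue 0 s I)
    (cong (λ t → 𝟙 t * (x ^ rowSum s * innerWeight w z m I))
          (Boolₚ.∧-zeroʳ (innerColsNonzeroᵇ s I ∧ not (rowSum s ℕ.≡ᵇ 0))))))
    (ℤₚ.*-zeroʳ (𝟙 (utsdᵇ m I)))

  term-1 : ∀ s I → term 1 s I ≡ 𝟙 (utsdᵇ m I) * innerWeight w z m I * (𝟙 (innerColsNonzeroᵇ s I) * x ^ rowSum s)
  term-1 s I = trans (cong (𝟙 (utsdᵇ m I) *_) (H-glue 1 s I))
    (trans (cong (λ t → 𝟙 (utsdᵇ m I) * (𝟙 t * (x ^ rowSum s * innerWeight w z m I)))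
                 (trans (Boolₚ.∧-identityʳ (innerColsNonzeroᵇ s I ∧ true))
                        (Boolₚ.∧-identityʳ (innerColsNonzeroᵇ s I))))
           (rearrange (𝟙 (utsdᵇ m I)) (𝟙 (innerColsNonzeroᵇ s I)) (x ^ rowSum s) (innerWeight w z m I)))
    where
    rearrange : ∀ u a p W → u * (a * (p * W)) ≡ u * W * (a * p)
    rearrange = solve-∀

  -- Each entry s_j ∈ {0, 1} contributes x ^ s_j, and may vanish only if the rest of its column is nonzero.
  ∑-topRows : ∀ I → ∑ topRows (λ s → 𝟙 (innerColsNonzeroᵇ s I) * x ^ rowSum s) ≡ columnProduct x m I
  ∑-topRows I =
    trans (∑-cong topRows (λ s → trans (cong₂ _*_ (𝟙-allᵇ (suc m) (columnNonzero s)) (^-Σ< x (suc m) (extend s)))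
                                       (∏<-* (suc m) (λ b → 𝟙 (columnNonzero s b)) (λ j → x ^ extend s j))))
    (trans (∑-allFuns-∏< (suc m) bits (λ j b → 𝟙 (not (b ℕ.+ colSum′ m I j ℕ.≡ᵇ 0)) * x ^ b))
           (∏<-cong (suc m) (λ j → identity (𝟙 (not (colSum′ m I j ℕ.≡ᵇ 0))) x)))
    where
    columnNonzero : (Fin (suc m) → ℕ) → ℕ → Bool
    columnNonzero s b = not (extend s b ℕ.+ colSum′ m I b ℕ.≡ᵇ 0)
    identity : ∀ a x → a * + 1 + (+ 1 * (x * + 1) + + 0) ≡ x + a
    identity = solve-∀

  ∑-topRows-term-1 : ∀ I → ∑ topRows (λ s → term 1 s I) ≡ reducedTerm m x w z I
  ∑-topRows-term-1 I = begin
    ∑ topRows (λ s → term 1 s I)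
      ≡⟨ ∑-cong topRows (λ s → term-1 s I) ⟩
    ∑ topRows (λ s → 𝟙 (utsdᵇ m I) * innerWeight w z m I * (𝟙 (innerColsNonzeroᵇ s I) * x ^ rowSum s))
      ≡⟨ ∑-*ˡ topRows (𝟙 (utsdᵇ m I) * innerWeight w z m I)
              (λ s → 𝟙 (innerColsNonzeroᵇ s I) * x ^ rowSum s) ⟩
    𝟙 (utsdᵇ m I) * innerWeight w z m I * ∑ topRows (λ s → 𝟙 (innerColsNonzeroᵇ s I) * x ^ rowSum s)
      ≡⟨ cong (𝟙 (utsdᵇ m I) * innerWeight w z m I *_) (∑-topRows I) ⟩
    𝟙 (utsdᵇ m I) * innerWeight w z m I * columnProduct x m I
      ≡⟨ ℤₚ.*-assoc (𝟙 (utsdᵇ m I)) (innerWeight w z m I) (columnProduct x m I) ⟩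
    reducedTerm m x w z I ∎
    where open ≡-Reasoning

  Sgf-reduction : Sgf (suc m) x w z ≡ ∑ (all01Matrices m) (reducedTerm m x w z)
  Sgf-reduction = begin
    Sgf (suc m) x w z
      ≡⟨ Sgf≡∑-utsd ⟩
    ∑ (all01Matrices K) (λ M → 𝟙 (utsdᵇ K M) * H M)
      ≡⟨ ∑-utsd-glue H H-cong ⟩
    ∑ bits (λ c → ∑ topRows (λ s → ∑ (all01Matrices m) (term c s)))
      ≡⟨ cong₂ _+_ cornerZero (ℤₚ.+-identityʳ cornerOne) ⟩
    + 0 + cornerOne
      ≡⟨ ℤₚ.+-identityˡ cornerOne ⟩
    cornerOne
      ≡⟨ ∑-swap topRows (all01Matrices m) (term 1) ⟩
    ∑ (all01Matrices m) (λ I → ∑ topRows (λ s → term 1 s I))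
      ≡⟨ ∑-cong (all01Matrices m) ∑-topRows-term-1 ⟩
    ∑ (all01Matrices m) (reducedTerm m x w z) ∎
    where
    open ≡-Reasoning
    cornerOne : ℤ
    cornerOne = ∑ topRows (λ s → ∑ (all01Matrices m) (term 1 s))
    cornerZero : ∑ topRows (λ s → ∑ (all01Matrices m) (term 0 s)) ≡ + 0
    cornerZero = trans (∑-cong topRows (λ s → trans (∑-cong (all01Matrices m) (term-0 s)) (∑-zero (all01Matrices m))))
                       (∑-zero topRows)

-- The recurrence

𝟙-Σ<≡ᵇ0 : ∀ n f → 𝟙 (Σ< n f ℕ.≡ᵇ 0) ≡ ∏< n (λ a → 𝟙 (f a ℕ.≡ᵇ 0))
𝟙-Σ<≡ᵇ0 zero f = refl
𝟙-Σ<≡ᵇ0 (suc n) f = trans (cong 𝟙 (+≡ᵇ0 (f 0) (Σ< n (λ a → f (suc a)))))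
  (trans (𝟙-∧ (f 0 ℕ.≡ᵇ 0) _) (cong (𝟙 (f 0 ℕ.≡ᵇ 0) *_) (𝟙-Σ<≡ᵇ0 n (λ a → f (suc a)))))
  where
  +≡ᵇ0 : ∀ a b → (a ℕ.+ b ℕ.≡ᵇ 0) ≡ (a ℕ.≡ᵇ 0) ∧ (b ℕ.≡ᵇ 0)
  +≡ᵇ0 zero b = refl
  +≡ᵇ0 (suc a) b = refl

module Recurrence (p : ℕ) (v w z : ℤ) where
  open Glue p

  x : ℤ
  x = v + w + v * w

  columnFactors : (Fin (suc p) → ℕ) → Matrix p → ℕ → ℤ
  columnFactors s I j = columnFactor v (extend s j ℕ.+ colSum′ p I j)

  factors : (Fin (suc p) → ℕ) → Matrix p → ℕ → ℤ
  factors s I j = w ^ extend s j * columnFactors s I j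

  rowFactors : (Fin (suc p) → ℕ) → Matrix p → ℤ
  rowFactors s I = w ^ rowSum s * ∏< (suc p) (columnFactors s I)

  rowFactors≡∏< : ∀ s I → rowFactors s I ≡ ∏< (suc p) (factors s I)
  rowFactors≡∏< s I = trans (cong (_* ∏< (suc p) (columnFactors s I)) (^-Σ< w (suc p) (extend s)))
                            (∏<-* (suc p) (λ j → w ^ extend s j) (columnFactors s I))

  emptyRow : (Fin (suc p) → ℕ) → ℤ
  emptyRow s = 𝟙 (rowSum s ℕ.≡ᵇ 0)

  reducedWeight-glue : ∀ c s I → reducedWeight K v w z (glue c s I) ≡
    innerWeight w z p I * z ^ c * ((v + + 0) * (rowFactors s I * columnFactor v (c ℕ.+ rowSum s)))
  reducedWeight-glue c s I = begin
    w ^ seAll K M * z ^ dgAll K M * ((v + + 0) * ∏< K (λ j → columnFactor v (colSum K M j)))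
      ≡⟨ cong₂ (λ a b → w ^ a * z ^ b * ((v + + 0) * ∏< K (λ j → columnFactor v (colSum K M j))))
               seAll-glue dgAll-glue ⟩
    w ^ (seAll p I ℕ.+ rowSum s) * z ^ (c ℕ.+ dgAll p I) * ((v + + 0) * ∏< K (λ j → columnFactor v (colSum K M j)))
      ≡⟨ cong (λ t → w ^ (seAll p I ℕ.+ rowSum s) * z ^ (c ℕ.+ dgAll p I) * ((v + + 0) * t)) lastColumnSplit ⟩
    w ^ (seAll p I ℕ.+ rowSum s) * z ^ (c ℕ.+ dgAll p I) * ((v + + 0) * (Q * columnFactor v (c ℕ.+ rowSum s)))
      ≡⟨ cong₂ (λ a b → a * b * ((v + + 0) * (Q * columnFactor v (c ℕ.+ rowSum s))))
               (ℤₚ.^-distribˡ-+-* w (seAll p I) (rowSum s)) (ℤₚ.^-distribˡ-+-* z c (dgAll p I)) ⟩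
    w ^ seAll p I * w ^ rowSum s * (z ^ c * z ^ dgAll p I) * ((v + + 0) * (Q * columnFactor v (c ℕ.+ rowSum s)))
      ≡⟨ rearrange (w ^ seAll p I) (w ^ rowSum s) (z ^ c) (z ^ dgAll p I) (v + + 0) Q (columnFactor v (c ℕ.+ rowSum s)) ⟩
    innerWeight w z p I * z ^ c * ((v + + 0) * (rowFactors s I * columnFactor v (c ℕ.+ rowSum s))) ∎
    where
    open ≡-Reasoning
    open GlueStats p c s I
    M : Matrix K
    M = glue c s I
    Q : ℤ
    Q = ∏< (suc p) (columnFactors s I)
    lastColumnSplit : ∏< K (λ j → columnFactor v (colSum K M j)) ≡ Q * columnFactor v (c ℕ.+ rowSum s)
    lastColumnSplit = trans (∏<-snoc (suc p) (λ j → columnFactor v (colSum K M j)))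
      (cong₂ _*_ (∏<-cong-< (suc p) (λ j j<K → cong (columnFactor v) (colSum-glue j (s≤s⁻¹ j<K))))
                 (cong (columnFactor v) colSum-glue-last))
    rearrange : ∀ wS wR zc zD v Q f → wS * wR * (zc * zD) * (v * (Q * f)) ≡ wS * zD * zc * (v * (wR * Q * f))
    rearrange = solve-∀

  -- The corner c lies on the anti-diagonal and completes the last column of the glued matrix.
  ∑-corner : ∀ s I → ∑ bits (λ c → reducedWeight K v w z (glue c s I)) ≡
    innerWeight w z p I * v * ((+ 1 + v) * (+ 1 + z) * rowFactors s I - rowFactors s I * emptyRow s)
  ∑-corner s I = trans
    (cong₂ _+_ (reducedWeight-glue 0 s I) (cong (_+ + 0) (reducedWeight-glue 1 s I)))
    (trans (cong (λ e → W * + 1 * ((v + + 0) * (R * (v + e))) + (W * (z * + 1) * ((v + + 0) * (R * (v + + 1))) + + 0))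
                 (𝟙-not (rowSum s ℕ.≡ᵇ 0)))
           (identity W v z R (emptyRow s)))
    where
    W R : ℤ
    W = innerWeight w z p I
    R = rowFactors s I
    identity : ∀ W v z R E →
      W * + 1 * ((v + + 0) * (R * (v + (+ 1 - E)))) + (W * (z * + 1) * ((v + + 0) * (R * (v + + 1))) + + 0)
      ≡ W * v * ((+ 1 + v) * (+ 1 + z) * R - R * E)
    identity = solve-∀

  -- A first-row entry lies in the SE region, hence carries weight w; summing it out turns each
  -- column factor v + [·] into x + [·].
  ∑-rowFactors : ∀ I → ∑ topRows (λ s → rowFactors s I) ≡ columnProduct x p I
  ∑-rowFactors I = trans (∑-cong topRows (λ s → rowFactors≡∏< s I))
    (trans (∑-allFuns-∏< (suc p) bits (λ j b → w ^ b * columnFactor v (b ℕ.+ colSum′ p I j)))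
           (∏<-cong (suc p) (λ j → identity (𝟙 (not (colSum′ p I j ℕ.≡ᵇ 0))) v w)))
    where
    identity : ∀ e v w → + 1 * (v + e) + (w * + 1 * (v + + 1) + + 0) ≡ v + w + v * w + e
    identity = solve-∀

  ∑-rowFactors-emptyRow : ∀ I → ∑ topRows (λ s → rowFactors s I * emptyRow s) ≡ columnProduct v p I
  ∑-rowFactors-emptyRow I = trans (∑-cong topRows (λ s → ∏<-factors s))
    (trans (∑-allFuns-∏< (suc p) bits (λ j b → w ^ b * columnFactor v (b ℕ.+ colSum′ p I j) * 𝟙 (b ℕ.≡ᵇ 0)))
           (∏<-cong (suc p) (λ j → identity (𝟙 (not (colSum′ p I j ℕ.≡ᵇ 0))) v w)))
    where
    ∏<-factors : ∀ s →
      rowFactors s I * emptyRow s ≡ ∏< (suc p) (λ j → factors s I j * 𝟙 (extend s j ℕ.≡ᵇ 0))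
    ∏<-factors s = trans (cong₂ _*_ (rowFactors≡∏< s I) (𝟙-Σ<≡ᵇ0 (suc p) (extend s)))
      (∏<-* (suc p) (factors s I) (λ j → 𝟙 (extend s j ℕ.≡ᵇ 0)))
    identity : ∀ e v w → + 1 * (v + e) * + 1 + (w * + 1 * (v + + 1) * + 0 + + 0) ≡ v + e
    identity = solve-∀

  ∑-corner-topRow : ∀ I → ∑ topRows (λ s → ∑ bits (λ c → reducedWeight K v w z (glue c s I))) ≡
    innerWeight w z p I * v * ((+ 1 + v) * (+ 1 + z) * columnProduct x p I - columnProduct v p I)
  ∑-corner-topRow I = begin
    ∑ topRows (λ s → ∑ bits (λ c → reducedWeight K v w z (glue c s I)))
      ≡⟨ ∑-cong topRows (λ s → ∑-corner s I) ⟩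
    ∑ topRows (λ s → C * (k * rowFactors s I - rowFactors s I * emptyRow s))
      ≡⟨ ∑-*ˡ topRows C (λ s → k * rowFactors s I - rowFactors s I * emptyRow s) ⟩
    C * ∑ topRows (λ s → k * rowFactors s I - rowFactors s I * emptyRow s)
      ≡⟨ cong (C *_) (∑-- topRows (λ s → k * rowFactors s I) (λ s → rowFactors s I * emptyRow s)) ⟩
    C * (∑ topRows (λ s → k * rowFactors s I) - ∑ topRows (λ s → rowFactors s I * emptyRow s))
      ≡⟨ cong (λ t → C * (t - ∑ topRows (λ s → rowFactors s I * emptyRow s)))
              (∑-*ˡ topRows k (λ s → rowFactors s I)) ⟩
    C * (k * ∑ topRows (λ s → rowFactors s I) - ∑ topRows (λ s → rowFactors s I * emptyRow s))
      ≡⟨ cong₂ (λ a b → C * (k * a - b)) (∑-rowFactors I) (∑-rowFactors-emptyRow I) ⟩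
    C * (k * columnProduct x p I - columnProduct v p I) ∎
    where
    open ≡-Reasoning
    k C : ℤ
    k = (+ 1 + v) * (+ 1 + z)
    C = innerWeight w z p I * v

  recurrence : Sgf (suc (suc (suc p))) v w z ≡ v * (+ 1 + v) * (+ 1 + z) * Sgf (suc p) x w z - v * Sgf (suc p) v w z
  recurrence = begin
    Sgf (suc (suc (suc p))) v w z
      ≡⟨ Reduction.Sgf-reduction K v w z ⟩
    ∑ (all01Matrices K) (reducedTerm K v w z)
      ≡⟨ ∑-utsd-glue (reducedWeight K v w z) (reducedWeight-cong K v w z) ⟩
    ∑ bits (λ c → ∑ topRows (λ s → ∑ (all01Matrices p) (λ I → T c s I)))
      ≡⟨ ∑-cong bits (λ c → ∑-swap topRows (all01Matrices p) (T c)) ⟩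
    ∑ bits (λ c → ∑ (all01Matrices p) (λ I → ∑ topRows (λ s → T c s I)))
      ≡⟨ ∑-swap bits (all01Matrices p) (λ c I → ∑ topRows (λ s → T c s I)) ⟩
    ∑ (all01Matrices p) (λ I → ∑ bits (λ c → ∑ topRows (λ s → T c s I)))
      ≡⟨ ∑-cong (all01Matrices p) perInner ⟩
    ∑ (all01Matrices p) (λ I → c₀ * reducedTerm p x w z I - v * reducedTerm p v w z I)
      ≡⟨ ∑-- (all01Matrices p) (λ I → c₀ * reducedTerm p x w z I) (λ I → v * reducedTerm p v w z I) ⟩
    ∑ (all01Matrices p) (λ I → c₀ * reducedTerm p x w z I) - ∑ (all01Matrices p) (λ I → v * reducedTerm p v w z I)
      ≡⟨ cong₂ _-_ (∑-*ˡ (all01Matrices p) c₀ (reducedTerm p x w z))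
                   (∑-*ˡ (all01Matrices p) v (reducedTerm p v w z)) ⟩
    c₀ * ∑ (all01Matrices p) (reducedTerm p x w z) - v * ∑ (all01Matrices p) (reducedTerm p v w z)
      ≡⟨ cong₂ (λ a b → c₀ * a - v * b)
               (sym (Reduction.Sgf-reduction p x w z)) (sym (Reduction.Sgf-reduction p v w z)) ⟩
    c₀ * Sgf (suc p) x w z - v * Sgf (suc p) v w z ∎
    where
    open ≡-Reasoning
    c₀ : ℤ
    c₀ = v * (+ 1 + v) * (+ 1 + z)
    T : ℕ → (Fin (suc p) → ℕ) → Matrix p → ℤ
    T c s I = 𝟙 (utsdᵇ p I) * reducedWeight K v w z (glue c s I)
    perInner : ∀ I →
      ∑ bits (λ c → ∑ topRows (λ s → T c s I)) ≡ c₀ * reducedTerm p x w z I - v * reducedTerm p v w z I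
    perInner I = begin
      ∑ bits (λ c → ∑ topRows (λ s → T c s I))
        ≡⟨ ∑-swap bits topRows (λ c s → T c s I) ⟩
      ∑ topRows (λ s → ∑ bits (λ c → T c s I))
        ≡⟨ ∑-cong topRows (λ s → ∑-*ˡ bits (𝟙 (utsdᵇ p I)) (λ c → reducedWeight K v w z (glue c s I))) ⟩
      ∑ topRows (λ s → 𝟙 (utsdᵇ p I) * ∑ bits (λ c → reducedWeight K v w z (glue c s I)))
        ≡⟨ ∑-*ˡ topRows (𝟙 (utsdᵇ p I)) (λ s → ∑ bits (λ c → reducedWeight K v w z (glue c s I))) ⟩
      𝟙 (utsdᵇ p I) * ∑ topRows (λ s → ∑ bits (λ c → reducedWeight K v w z (glue c s I)))
        ≡⟨ cong (𝟙 (utsdᵇ p I) *_) (∑-corner-topRow I) ⟩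
      𝟙 (utsdᵇ p I) * (innerWeight w z p I * v * ((+ 1 + v) * (+ 1 + z) * columnProduct x p I - columnProduct v p I))
        ≡⟨ identity (𝟙 (utsdᵇ p I)) (innerWeight w z p I) v z (columnProduct x p I) (columnProduct v p I) ⟩
      c₀ * reducedTerm p x w z I - v * reducedTerm p v w z I ∎
      where
      identity : ∀ u W v z Px Pv → u * (W * v * ((+ 1 + v) * (+ 1 + z) * Px - Pv))
                 ≡ v * (+ 1 + v) * (+ 1 + z) * (u * (W * Px)) - v * (u * (W * Pv))
      identity = solve-∀

lemma14-base : ∀ (v w z : ℤ) → Sgf 2 v w z ≡ v * (+ 1 + v) * (+ 1 + z) * Sgf 0 (v + w + v * w) w z - v * Sgf 0 v w z
lemma14-base v w z = trans (Reduction.Sgf-reduction 1 v w z) (identity v z)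
  where
  identity : ∀ v z → + 1 * (+ 1 * + 1 * ((v + + 0) * ((v + + 0) * + 1)))
                     + (+ 1 * (+ 1 * (z * + 1) * ((v + + 0) * ((v + + 1) * + 1))) + + 0)
                   ≡ v * (+ 1 + v) * (+ 1 + z) * + 1 - v * + 1
  identity = solve-∀

lemma14 : ∀ (n : ℕ) (v w z : ℤ) →
    Sgf (suc (suc n)) v w z
      ≡ v * (+ 1 + v) * (+ 1 + z) * Sgf n (v + w + v * w) w z - v * Sgf n v w z
lemma14 zero v w z = lemma14-base v w z
lemma14 (suc p) v w z = Recurrence.recurrence p v w z
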